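{- Let $e\geq 2$ and let $\Gamma_e=VO^+(2e,2)$, realised on the set of all $2\times e$ matrices over $\mathbb{F}_2$. Let $W_1$ be the set of matrices whose second row is zero; let $W_2$ be the set of matrices whose entry in position $(1,e)$ is $0$ and whose second row is zero except possibly in position $(2,e)$; let $v$ be the matrix with entry $1$ in position $(2,e-1)$ and $0$ elsewhere. Let $\Gamma_{e,1}$ be the graph obtained from $\Gamma_e$ by first switching the edges between $W_1$ and $v+W_1$, and then switching the edges between $W_2$ and $v+W_2$. Then $\Gamma_{e,1}$ is a strictly Neumaier graph that is edge-regular with parameters $$\bigl(2^{2e},\ (2^{e-1}+1)(2^e-1),\ 2(2^{e-2}+1)(2^{e-1}-1)\bigr)$$ and contains a $2^{e-1}$-regular $2^e$-clique. Further, with $\mu=2^{e-1}(2^{e-1}+1)$, the numbers of common neighbours of pairs of distinct non-adjacent vertices of $\Gamma_{e,1}$ take exactly the values $\mu-2^{e-1}$, $\mu$ and $\mu+2^{e-1}$.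
   Context: All graphs are finite, simple and undirected. For a $2\times e$ matrix $x=(x_{ij})$ over $\mathbb{F}_2$ define $Q(x)=\sum_{j=1}^{e} x_{1j}x_{2j}$ (the scalar product of its two rows; equivalently the hyperbolic quadratic form $x_1x_2+x_3x_4+\dots+x_{2e-1}x_{2e}$ on $\mathbb{F}_2^{2e}$). The affine polar graph $VO^+(2e,2)$ has vertex set the $2\times e$ matrices over $\mathbb{F}_2$, two distinct matrices $x,y$ adjacent iff $Q(x-y)=0$; it is strongly regular with parameters $(2^{2e},(2^{e-1}+1)(2^e-1),2(2^{e-2}+1)(2^{e-1}-1),2^{e-1}(2^{e-1}+1))$. For a set $X$ of matrices and a matrix $v$, $v+X=\{v+x: x\in X\}$. For disjoint vertex sets $S,T$ of a graph, switching the edges between $S$ and $T$ means: for each $x\in S$ and each $t\in T$, delete the edge $xt$ if present and insert it if absent. A graph on $v$ vertices is edge-regular with parameters $(v,k,\lambda)$ if it has at least one edge, is $k$-regular, and every two adjacent vertices have exactly $\lambda$ common neighbours; it is strongly regular if additionally it is non-complete and any two distinct non-adjacent vertices have a constant number of common neighbours. A clique $S$ in a regular graph is $m$-regular if every vertex outside $S$ is adjacent to exactly $m>0$ vertices of $S$. A strictly Neumaier graph is a non-complete edge-regular graph containing a regular clique which is not strongly regular. -}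

module Defs where

open import Data.Bool using (Bool; true; false; _∧_; _∨_; not; _xor_)
import Data.Bool as B
open import Data.Nat using (ℕ; zero; suc; _+_; _*_; _∸_; _^_; _≤_; _<_; s≤s; z≤n)
open import Data.Fin using (Fin; fromℕ; inject₁)
open import Data.Vec using (Vec; []; _∷_; lookup; zipWith; foldr; replicate; updateAt)
import Data.Vec.Properties as VP
import Data.Product.Properties as PP
open import Data.Product using (Σ; ∃; ∃-syntax; _×_; _,_; proj₁; proj₂)
open import Data.List using (List; []; _∷_; length; filter; map; concatMap; _++_)
open import Data.List.Membership.Propositional using (_∈_; _∉_)
open import Data.List.Relation.Unary.Unique.Propositional using (Unique)
open import Relation.Binary.PropositionalEquality using (_≡_; _≢_; refl)
open import Relation.Binary.Definitions using (DecidableEquality)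
open import Relation.Nullary using (¬_; Dec; yes; no; does)
open import Relation.Nullary.Decidable using (⌊_⌋)
open import Data.List.Membership.DecPropositional using () renaming (_∈?_ to ∈?-gen)

-- Generic finite graphs: a vertex type V, an enumeration `verts` of the
-- vertex set (each vertex listed exactly once), and a Bool-valued
-- adjacency relation.

module _ {V : Set} (verts : List V) (adj : V → V → Bool) where

  degree : V → ℕ
  degree x = length (filter (λ z → adj x z B.≟ true) verts)

  common : V → V → ℕ
  common x y = length (filter (λ z → (adj x z ∧ adj y z) B.≟ true) verts)

  NonComplete : Set
  NonComplete = ∃[ x ] ∃[ y ] (x ∈ verts × y ∈ verts × x ≢ y × adj x y ≡ false)

  EdgeRegular : ℕ → ℕ → ℕ → Set
  EdgeRegular v k l =
    length verts ≡ v
    × (∃[ x ] ∃[ y ] (x ∈ verts × y ∈ verts × adj x y ≡ true))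
    × (∀ x → x ∈ verts → degree x ≡ k)
    × (∀ x y → x ∈ verts → y ∈ verts → adj x y ≡ true → common x y ≡ l)

  StronglyRegular : Set
  StronglyRegular =
    (∃[ v ] ∃[ k ] ∃[ l ] EdgeRegular v k l)
    × NonComplete
    × (∃[ μ ] (∀ x y → x ∈ verts → y ∈ verts → x ≢ y → adj x y ≡ false
                → common x y ≡ μ))

  IsClique : List V → Set
  IsClique S =
    Unique S
    × (∀ x → x ∈ S → x ∈ verts)
    × (∀ x y → x ∈ S → y ∈ S → x ≢ y → adj x y ≡ true)

  nbrsIn : List V → V → ℕ
  nbrsIn S x = length (filter (λ z → adj x z B.≟ true) S)

  RegularClique : ℕ → List V → Set
  RegularClique m S =
    IsClique S × 0 < m × (∀ x → x ∈ verts → x ∉ S → nbrsIn S x ≡ m)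

  StrictlyNeumaier : Set
  StrictlyNeumaier =
    NonComplete
    × (∃[ v ] ∃[ k ] ∃[ l ] EdgeRegular v k l)
    × (∃[ m ] ∃[ S ] RegularClique m S)
    × ¬ StronglyRegular

  switch : DecidableEquality V → List V → List V → V → V → Bool
  switch _≟_ S T x y =
    adj x y xor ((mem x S ∧ mem y T) ∨ (mem x T ∧ mem y S))
    where
      mem : V → List V → Bool
      mem z L = does (∈?-gen _≟_ z L)

-- 2 × e matrices over F₂ (Bool with xor as addition, ∧ as product),
-- represented as (first row , second row).

Mat : ℕ → Set
Mat e = Vec Bool e × Vec Bool e

_≟M_ : ∀ {e} → DecidableEquality (Mat e)
_≟M_ = PP.≡-dec (VP.≡-dec B._≟_) (VP.≡-dec B._≟_)

_+M_ : ∀ {e} → Mat e → Mat e → Mat e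
(a , b) +M (c , d) = zipWith _xor_ a c , zipWith _xor_ b d

Q : ∀ {e} → Mat e → Bool
Q (a , b) = foldr _ _xor_ false (zipWith _∧_ a b)

allVecs : ∀ n → List (Vec Bool n)
allVecs zero = [] ∷ []
allVecs (suc n) = concatMap (λ v → (false ∷ v) ∷ (true ∷ v) ∷ []) (allVecs n)

allMats : ∀ e → List (Mat e)
allMats e = concatMap (λ a → map (λ b → (a , b)) (allVecs e)) (allVecs e)

-- adjacency in VO⁺(2e,2): distinct and Q(x - y) = 0  (x - y = x + y)
adjVO : ∀ {e} → Mat e → Mat e → Bool
adjVO x y = not ⌊ x ≟M y ⌋ ∧ not (Q (x +M y))

_+L_ : ∀ {e} → Mat e → List (Mat e) → List (Mat e)
v +L X = map (v +M_) X

-- column e (last) and column e-1 (0-based indices e-1 and e-2), for e ≥ 2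
colE : ∀ {e} → 2 ≤ e → Fin e
colE (s≤s (s≤s {n = n} _)) = fromℕ (suc n)

colE-1 : ∀ {e} → 2 ≤ e → Fin e
colE-1 (s≤s (s≤s {n = n} _)) = inject₁ (fromℕ n)

allFalse : ∀ {n} → Vec Bool n → Bool
allFalse v = foldr _ (λ b r → not b ∧ r) true v

W₁ : ∀ e → List (Mat e)
W₁ e = filter (λ x → allFalse (proj₂ x) B.≟ true) (allMats e)

W₂ : ∀ e → 2 ≤ e → List (Mat e)
W₂ e h = filter (λ x → (not (lookup (proj₁ x) (colE h))
                         ∧ allFalse (updateAt (proj₂ x) (colE h) (λ _ → false)))
                        B.≟ true)
                (allMats e)

vMat : ∀ e → 2 ≤ e → Mat e
vMat e h = replicate e false , updateAt (replicate e false) (colE-1 h) (λ _ → true)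

adjΓ : ∀ e → 2 ≤ e → Mat e → Mat e → Bool
adjΓ e h =
  switch (allMats e) (switch (allMats e) adjVO _≟M_ (W₁ e) (vMat e h +L W₁ e))
         _≟M_ (W₂ e h) (vMat e h +L W₂ e h)

module Submission where

-- Write e = n + 2 and split a 2 × e matrix into its first n columns (the prefix)
-- and its last two columns (the suffix).  W₁, W₂ and v see only the suffix and
-- whether the second row of the prefix vanishes, so distinct x, z are adjacent
-- in Γ_{e,1} iff  Qˢ(x,z) = Q(x+z) + [xz is switched]  vanishes, where the
-- switching term is [both prefixes zero] · (a function of the two suffixes).
--
-- All counts are integer character sums.  With σ = (-1)^Q(x+·) and ω = [switched],
-- the closed-neighbourhood indicator satisfies 2·nbr = 1 + σ(1 - 2ω); hence
-- degrees, common neighbours and neighbours in W₁ are integer combinations of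
-- sums over z of monomials in σ(x,z), σ(y,z), ω(x,z), ω(y,z), [z ∈ W₁].  Such a
-- sum factorises into a product of factors, one per prefix column, times a sum
-- over the 16 suffixes; the column factors and the finitely many suffix sums are
-- evaluated by exhaustive computation.  With P = 2^(e-2) this gives
-- degree 8P² + 2P - 1, λ = 4P² + 2P - 2, the values 4P² + {0, 2P, 4P} for
-- non-adjacent pairs (each realised by explicit vertices with zero prefix), and
-- 2P neighbours in W₁ for every vertex outside W₁.

open import Defs
open import Data.Nat using (ℕ; zero; suc; _+_; _*_; _∸_; _^_; _≤_; s≤s; z≤n)
import Data.Nat.Properties as ℕP
open import Data.Integer using (ℤ; +_; NonZero)
  renaming (_+_ to _+ℤ_; _*_ to _*ℤ_; -_ to -ℤ_; _≟_ to _≟ℤ_)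
import Data.Integer.Properties as ℤP
open import Data.Integer.Tactic.RingSolver using (solve-∀)
open import Data.Bool using (Bool; true; false; _∧_; _∨_; not; _xor_)
import Data.Bool as B
import Data.Bool.Properties as BP
open import Data.Vec using (Vec; []; _∷_; lookup; updateAt; zipWith)
open import Data.Product using (∃-syntax; _×_; _,_; proj₁; proj₂)
open import Data.Sum using (_⊎_; inj₁; inj₂)
open import Data.List
  using (List; []; _∷_; length; filter; map; concatMap; _++_; foldr; cartesianProductWith; cartesianProduct)
import Data.List.Properties as LP
open import Data.List.Membership.Propositional using (_∈_; _∉_)
open import Data.List.Membership.Propositional.Properties
  using (∈-cartesianProductWith⁺; ∈-cartesianProduct⁺; ∈-filter⁺; ∈-filter⁻; ∈-map⁺; ∈-map⁻)
open import Data.List.Membership.DecPropositional using () renaming (_∈?_ to ∈?-gen)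
open import Data.List.Relation.Unary.All using (All; []; _∷_)
open import Data.List.Relation.Unary.Any using (here; there)
open import Data.List.Relation.Unary.Unique.Propositional using (Unique; []; _∷_)
open import Data.List.Relation.Unary.Unique.Propositional.Properties
  using (cartesianProductWith⁺; cartesianProduct⁺; filter⁺)
open import Data.Empty using (⊥-elim)
open import Relation.Binary.PropositionalEquality
open import Relation.Binary.Definitions using (DecidableEquality)
open import Relation.Nullary using (Dec; yes; no; does; ¬_)
open import Relation.Nullary.Decidable using (⌊_⌋)

∧-true : ∀ {a b} → a ∧ b ≡ true → a ≡ true × b ≡ true
∧-true {true} {true} refl = refl , refl

not≡true : ∀ {b} → not b ≡ true → b ≡ false
not≡true {false} refl = refl

∨-right : ∀ {a b} → a ∨ b ≡ true → a ≡ false → b ≡ true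
∨-right h refl = h

⌊⌋-true : ∀ {A : Set} (d : Dec A) → A → ⌊ d ⌋ ≡ true
⌊⌋-true (yes _) _ = refl
⌊⌋-true (no ¬a) a = ⊥-elim (¬a a)

⌊⌋-false : ∀ {A : Set} (d : Dec A) → ¬ A → ⌊ d ⌋ ≡ false
⌊⌋-false (yes a) ¬a = ⊥-elim (¬a a)
⌊⌋-false (no _)  _  = refl

does-⇔ : ∀ {A C : Set} → (A → C) → (C → A) → (a : Dec A) (c : Dec C) → does a ≡ does c
does-⇔ f g (yes a) (yes c) = refl
does-⇔ f g (yes a) (no ¬c) = ⊥-elim (¬c (f a))
does-⇔ f g (no ¬a) (yes c) = ⊥-elim (¬a (g c))
does-⇔ f g (no ¬a) (no ¬c) = refl

does-≟true : ∀ c → does (c B.≟ true) ≡ c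
does-≟true false = refl
does-≟true true  = refl

infix 5 _==_
_==_ : ℤ → ℤ → Bool
a == b = ⌊ a ≟ℤ b ⌋

==-sound : ∀ a b → a == b ≡ true → a ≡ b
==-sound a b h with a ≟ℤ b
... | yes a≡b = a≡b

ind : Bool → ℤ
ind true  = + 1
ind false = + 0

ind-∧ : ∀ a b → ind (a ∧ b) ≡ ind a *ℤ ind b
ind-∧ false b     = refl
ind-∧ true  false = refl
ind-∧ true  true  = refl

ΣVec : ∀ n → (Vec Bool n → ℤ) → ℤ
ΣVec zero    f = f []
ΣVec (suc n) f = ΣVec n (λ v → f (false ∷ v) +ℤ f (true ∷ v))

ΣMat : ∀ n → (Mat n → ℤ) → ℤ
ΣMat n f = ΣVec n (λ a → ΣVec n (λ b → f (a , b)))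

ΣVec-cong : ∀ n {f g : Vec Bool n → ℤ} → (∀ v → f v ≡ g v) → ΣVec n f ≡ ΣVec n g
ΣVec-cong zero    eq = eq []
ΣVec-cong (suc n) eq = ΣVec-cong n (λ v → cong₂ _+ℤ_ (eq _) (eq _))

ΣVec-+ : ∀ n (f g : Vec Bool n → ℤ) → ΣVec n (λ v → f v +ℤ g v) ≡ ΣVec n f +ℤ ΣVec n g
ΣVec-+ zero    f g = refl
ΣVec-+ (suc n) f g =
  trans (ΣVec-cong n (λ v → interchange (f (false ∷ v)) (g (false ∷ v)) (f (true ∷ v)) (g (true ∷ v))))
        (ΣVec-+ n (λ v → f (false ∷ v) +ℤ f (true ∷ v)) (λ v → g (false ∷ v) +ℤ g (true ∷ v)))
  where
  interchange : ∀ a b c d → (a +ℤ b) +ℤ (c +ℤ d) ≡ (a +ℤ c) +ℤ (b +ℤ d)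
  interchange = solve-∀

ΣVec-* : ∀ n (k : ℤ) (f : Vec Bool n → ℤ) → ΣVec n (λ v → k *ℤ f v) ≡ k *ℤ ΣVec n f
ΣVec-* zero    k f = refl
ΣVec-* (suc n) k f =
  trans (ΣVec-cong n (λ v → sym (ℤP.*-distribˡ-+ k (f (false ∷ v)) (f (true ∷ v)))))
        (ΣVec-* n k (λ v → f (false ∷ v) +ℤ f (true ∷ v)))

ΣVec-const : ∀ n (c : ℤ) → ΣVec n (λ _ → c) ≡ + (2 ^ n) *ℤ c
ΣVec-const zero    c = sym (ℤP.*-identityˡ c)
ΣVec-const (suc n) c =
  trans (ΣVec-const n (c +ℤ c))
        (trans (double (+ (2 ^ n)) c) (cong (_*ℤ c) (sym (ℤP.pos-* 2 (2 ^ n)))))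
  where
  double : ∀ p c → p *ℤ (c +ℤ c) ≡ (+ 2 *ℤ p) *ℤ c
  double = solve-∀

ΣMat-cong : ∀ n {f g : Mat n → ℤ} → (∀ x → f x ≡ g x) → ΣMat n f ≡ ΣMat n g
ΣMat-cong n eq = ΣVec-cong n (λ a → ΣVec-cong n (λ b → eq (a , b)))

ΣMat-+ : ∀ n (f g : Mat n → ℤ) → ΣMat n (λ x → f x +ℤ g x) ≡ ΣMat n f +ℤ ΣMat n g
ΣMat-+ n f g =
  trans (ΣVec-cong n (λ a → ΣVec-+ n (λ b → f (a , b)) (λ b → g (a , b)))) (ΣVec-+ n _ _)

ΣMat-* : ∀ n (k : ℤ) (f : Mat n → ℤ) → ΣMat n (λ x → k *ℤ f x) ≡ k *ℤ ΣMat n f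
ΣMat-* n k f = trans (ΣVec-cong n (λ a → ΣVec-* n k (λ b → f (a , b)))) (ΣVec-* n k _)

ΣMat-const : ∀ n (c : ℤ) → ΣMat n (λ _ → c) ≡ + (2 ^ n) *ℤ (+ (2 ^ n) *ℤ c)
ΣMat-const n c =
  trans (ΣVec-cong n (λ _ → ΣVec-const n c)) (ΣVec-const n (+ (2 ^ n) *ℤ c))

colSum : (Bool → Bool → ℤ) → ℤ
colSum g = (g false false +ℤ g false true) +ℤ (g true false +ℤ g true true)

ΣMat-column : ∀ n (f : Mat (suc n) → ℤ) →
  ΣMat (suc n) f ≡ colSum (λ a₀ b₀ → ΣMat n (λ x → f (a₀ ∷ proj₁ x , b₀ ∷ proj₂ x)))
ΣMat-column n f =
  trans (ΣVec-cong n (λ a → cong₂ _+ℤ_ (ΣVec-+ n (λ b → f (false ∷ a , false ∷ b))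
                                                  (λ b → f (false ∷ a , true ∷ b)))
                                       (ΣVec-+ n (λ b → f (true ∷ a , false ∷ b))
                                                  (λ b → f (true ∷ a , true ∷ b)))))
        (trans (ΣVec-+ n _ _) (cong₂ _+ℤ_ (ΣVec-+ n _ _) (ΣVec-+ n _ _)))

ΣMat-factor : ∀ n (f : Mat (suc n) → ℤ) (g : Bool → Bool → ℤ) (h : Mat n → ℤ) →
  (∀ a₀ b₀ a b → f (a₀ ∷ a , b₀ ∷ b) ≡ g a₀ b₀ *ℤ h (a , b)) →
  ΣMat (suc n) f ≡ colSum g *ℤ ΣMat n h
ΣMat-factor n f g h eq =
  trans (ΣMat-column n f)
  (trans (cong₂ _+ℤ_ (cong₂ _+ℤ_ (column false false) (column false true))
                     (cong₂ _+ℤ_ (column true false) (column true true)))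
         (collect (g false false) (g false true) (g true false) (g true true) (ΣMat n h)))
  where
  column : ∀ a₀ b₀ → ΣMat n (λ x → f (a₀ ∷ proj₁ x , b₀ ∷ proj₂ x)) ≡ g a₀ b₀ *ℤ ΣMat n h
  column a₀ b₀ = trans (ΣMat-cong n (λ x → eq a₀ b₀ (proj₁ x) (proj₂ x))) (ΣMat-* n (g a₀ b₀) h)
  collect : ∀ a b c d s → (a *ℤ s +ℤ b *ℤ s) +ℤ (c *ℤ s +ℤ d *ℤ s) ≡ ((a +ℤ b) +ℤ (c +ℤ d)) *ℤ s
  collect = solve-∀

-- The enumerations of Defs are Cartesian products, which gives completeness
-- and absence of repetitions from the library.
concatMap-map : ∀ {A B C : Set} (f : A → B → C) (xs : List A) (ys : List B) →
  concatMap (λ x → map (f x) ys) xs ≡ cartesianProductWith f xs ys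
concatMap-map f []       ys = refl
concatMap-map f (x ∷ xs) ys = cong (map (f x) ys ++_) (concatMap-map f xs ys)

bools : List Bool
bools = false ∷ true ∷ []

allVecs-suc : ∀ n → allVecs (suc n) ≡ cartesianProductWith (λ v b → b ∷ v) (allVecs n) bools
allVecs-suc n = concatMap-map (λ v b → b ∷ v) (allVecs n) bools

allMats-product : ∀ n → allMats n ≡ cartesianProduct (allVecs n) (allVecs n)
allMats-product n = concatMap-map _,_ (allVecs n) (allVecs n)

allVecs-complete : ∀ n (v : Vec Bool n) → v ∈ allVecs n
allVecs-complete zero    []      = here refl
allVecs-complete (suc n) (b ∷ v) =
  subst (λ L → (b ∷ v) ∈ L) (sym (allVecs-suc n))
        (∈-cartesianProductWith⁺ (λ v b → b ∷ v) (allVecs-complete n v) (bool∈ b))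
  where
  bool∈ : ∀ b → b ∈ bools
  bool∈ false = here refl
  bool∈ true  = there (here refl)

allMats-complete : ∀ n (x : Mat n) → x ∈ allMats n
allMats-complete n (a , b) =
  subst (λ L → (a , b) ∈ L) (sym (allMats-product n))
        (∈-cartesianProduct⁺ (allVecs-complete n a) (allVecs-complete n b))

allVecs-unique : ∀ n → Unique (allVecs n)
allVecs-unique zero    = [] ∷ []
allVecs-unique (suc n) =
  subst Unique (sym (allVecs-suc n))
        (cartesianProductWith⁺ (λ v b → b ∷ v) cons-injective (allVecs-unique n) bools-unique)
  where
  cons-injective : ∀ {v w : Vec Bool n} {b c} → b ∷ v ≡ c ∷ w → v ≡ w × b ≡ c
  cons-injective refl = refl , refl
  bools-unique : Unique bools
  bools-unique = ((λ ()) ∷ []) ∷ [] ∷ []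

allMats-unique : ∀ n → Unique (allMats n)
allMats-unique n =
  subst Unique (sym (allMats-product n)) (cartesianProduct⁺ (allVecs-unique n) (allVecs-unique n))

sumL : List ℤ → ℤ
sumL = foldr _+ℤ_ (+ 0)

sumL-++ : ∀ xs ys → sumL (xs ++ ys) ≡ sumL xs +ℤ sumL ys
sumL-++ []       ys = sym (ℤP.+-identityˡ _)
sumL-++ (x ∷ xs) ys = trans (cong (x +ℤ_) (sumL-++ xs ys)) (sym (ℤP.+-assoc x _ _))

sumL-cong : ∀ {A : Set} {f g : A → ℤ} (L : List A) → (∀ x → f x ≡ g x) →
  sumL (map f L) ≡ sumL (map g L)
sumL-cong []      eq = refl
sumL-cong (x ∷ L) eq = cong₂ _+ℤ_ (eq x) (sumL-cong L eq)

sumL-cartesian : ∀ {A B C : Set} (f : A → B → C) (g : C → ℤ) xs ys →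
  sumL (map g (cartesianProductWith f xs ys)) ≡ sumL (map (λ x → sumL (map (λ y → g (f x y)) ys)) xs)
sumL-cartesian f g []       ys = refl
sumL-cartesian f g (x ∷ xs) ys =
  trans (cong sumL (LP.map-++ g (map (f x) ys) _))
  (trans (sumL-++ (map g (map (f x) ys)) _)
         (cong₂ _+ℤ_ (cong sumL (sym (LP.map-∘ ys))) (sumL-cartesian f g xs ys)))

allVecs-sum : ∀ n (f : Vec Bool n → ℤ) → sumL (map f (allVecs n)) ≡ ΣVec n f
allVecs-sum zero    f = ℤP.+-identityʳ _
allVecs-sum (suc n) f =
  trans (cong (λ L → sumL (map f L)) (allVecs-suc n))
  (trans (sumL-cartesian (λ v b → b ∷ v) f (allVecs n) bools)
  (trans (sumL-cong (allVecs n) (λ v → cong (f (false ∷ v) +ℤ_) (ℤP.+-identityʳ (f (true ∷ v)))))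
         (allVecs-sum n (λ v → f (false ∷ v) +ℤ f (true ∷ v)))))

allMats-sum : ∀ n (f : Mat n → ℤ) → sumL (map f (allMats n)) ≡ ΣMat n f
allMats-sum n f =
  trans (cong (λ L → sumL (map f L)) (allMats-product n))
  (trans (sumL-cartesian _,_ f (allVecs n) (allVecs n))
  (trans (sumL-cong (allVecs n) (λ a → allVecs-sum n (λ b → f (a , b))))
         (allVecs-sum n _)))

count-sum : ∀ {A : Set} (b : A → Bool) (L : List A) →
  + length (filter (λ z → b z B.≟ true) L) ≡ sumL (map (λ z → ind (b z)) L)
count-sum b []      = refl
count-sum b (x ∷ L) with b x
... | true  = trans (ℤP.pos-+ 1 _) (cong (+ 1 +ℤ_) (count-sum b L))
... | false = trans (count-sum b L) (sym (ℤP.+-identityˡ _))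

filter-sum : ∀ {A : Set} (g : A → ℤ) (r : A → Bool) (L : List A) →
  sumL (map g (filter (λ z → r z B.≟ true) L)) ≡ sumL (map (λ z → g z *ℤ ind (r z)) L)
filter-sum g r []      = refl
filter-sum g r (x ∷ L) with r x
... | true  = cong₂ _+ℤ_ (sym (ℤP.*-identityʳ (g x))) (filter-sum g r L)
... | false =
  trans (filter-sum g r L) (sym (trans (cong (_+ℤ _) (ℤP.*-zeroʳ (g x))) (ℤP.+-identityˡ _)))

count-allMats : ∀ n (b : Mat n → Bool) →
  + length (filter (λ z → b z B.≟ true) (allMats n)) ≡ ΣMat n (λ z → ind (b z))
count-allMats n b = trans (count-sum b (allMats n)) (allMats-sum n _)

count-filtered : ∀ n (b r : Mat n → Bool) →
  + length (filter (λ z → b z B.≟ true) (filter (λ z → r z B.≟ true) (allMats n)))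
  ≡ ΣMat n (λ z → ind (b z) *ℤ ind (r z))
count-filtered n b r =
  trans (count-sum b (filter (λ z → r z B.≟ true) (allMats n)))
        (trans (filter-sum (λ z → ind (b z)) r (allMats n)) (allMats-sum n _))

module _ {A : Set} (_≟_ : DecidableEquality A) (g : A → ℤ) where

  δ-sum : A → List A → ℤ
  δ-sum x L = sumL (map (λ z → ind ⌊ x ≟ z ⌋ *ℤ g z) L)

  δ-sum-absent : ∀ x L → All (x ≢_) L → δ-sum x L ≡ + 0
  δ-sum-absent x []      []           = refl
  δ-sum-absent x (z ∷ L) (x≢z ∷ x∉L) with x ≟ z
  ... | yes x≡z = ⊥-elim (x≢z x≡z)
  ... | no  _   = trans (ℤP.+-identityˡ _) (δ-sum-absent x L x∉L)

  δ-sum-present : ∀ x L → Unique L → x ∈ L → δ-sum x L ≡ g x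
  δ-sum-present x (z ∷ L) (z∉L ∷ uL) x∈zL with x ≟ z | x∈zL
  ... | yes refl | _ =
    trans (cong₂ _+ℤ_ (ℤP.*-identityˡ (g x)) (δ-sum-absent x L z∉L))
          (ℤP.+-identityʳ (g x))
  ... | no x≢z | here x≡z  = ⊥-elim (x≢z x≡z)
  ... | no _   | there x∈L = trans (ℤP.+-identityˡ _) (δ-sum-present x L uL x∈L)

ΣMat-δ : ∀ n (x : Mat n) (g : Mat n → ℤ) → ΣMat n (λ z → ind ⌊ x ≟M z ⌋ *ℤ g z) ≡ g x
ΣMat-δ n x g =
  trans (sym (allMats-sum n _))
        (δ-sum-present _≟M_ g x (allMats n) (allMats-unique n) (allMats-complete n x))

-- Exhaustive verification of a Boolean property of all vectors / matrices of a
-- given size: the test computes, and its soundness turns `refl` into a proof.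
allVec : ∀ n → (Vec Bool n → Bool) → Bool
allVec zero    p = p []
allVec (suc n) p = allVec n (λ v → p (false ∷ v) ∧ p (true ∷ v))

allVec-sound : ∀ n p → allVec n p ≡ true → ∀ v → p v ≡ true
allVec-sound zero    p h []      = h
allVec-sound (suc n) p h (b ∷ v) with ∧-true {p (false ∷ v)} {p (true ∷ v)} (allVec-sound n _ h v)
allVec-sound (suc n) p h (false ∷ v) | p₀ , _  = p₀
allVec-sound (suc n) p h (true ∷ v)  | _  , p₁ = p₁

allMat : ∀ n → (Mat n → Bool) → Bool
allMat n p = allVec n (λ a → allVec n (λ b → p (a , b)))

allMat-sound : ∀ n p → allMat n p ≡ true → ∀ x → p x ≡ true
allMat-sound n p h (a , b) = allVec-sound n _ (allVec-sound n _ h a) b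

allPairs : (Mat 2 → Mat 2 → Bool) → Bool
allPairs p = allMat 2 (λ u → allMat 2 (p u))

allPairs-sound : ∀ p → allPairs p ≡ true → ∀ u w → p u w ≡ true
allPairs-sound p h u w = allMat-sound 2 (p u) (allMat-sound 2 (λ u → allMat 2 (p u)) h u) w

xorVec-cancel : ∀ {e} (u w : Vec Bool e) → zipWith _xor_ u (zipWith _xor_ u w) ≡ w
xorVec-cancel []      []      = refl
xorVec-cancel (u ∷ us) (w ∷ ws) =
  cong₂ _∷_ (trans (sym (BP.xor-assoc u u w)) (cong (_xor w) (BP.xor-same u))) (xorVec-cancel us ws)

+M-cancel : ∀ {e} (v x : Mat e) → v +M (v +M x) ≡ x
+M-cancel (v₁ , v₂) (x₁ , x₂) = cong₂ _,_ (xorVec-cancel v₁ x₁) (xorVec-cancel v₂ x₂)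

Q-self : ∀ {e} (x : Mat e) → Q (x +M x) ≡ false
Q-self ([]     , [])     = refl
Q-self (a ∷ as , b ∷ bs) rewrite BP.xor-same a = Q-self (as , bs)

Q-comm : ∀ {e} (x z : Mat e) → Q (x +M z) ≡ Q (z +M x)
Q-comm ([]     , [])     ([]     , [])     = refl
Q-comm (a ∷ as , b ∷ bs) (c ∷ cs , d ∷ ds)
  rewrite BP.xor-comm a c | BP.xor-comm b d | Q-comm (as , bs) (cs , ds) = refl

mem : ∀ {e} → Mat e → List (Mat e) → Bool
mem x L = does (∈?-gen _≟M_ x L)

mem-filter : ∀ n (b : Mat n → Bool) x → mem x (filter (λ z → b z B.≟ true) (allMats n)) ≡ b x
mem-filter n b x =
  trans (does-⇔ (λ x∈ → proj₂ (∈-filter⁻ b? {xs = allMats n} x∈))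
                (∈-filter⁺ b? {xs = allMats n} (allMats-complete n x))
                (∈?-gen _≟M_ x _) (b x B.≟ true))
        (does-≟true (b x))
  where b? = λ z → b z B.≟ true

mem-translate : ∀ {e} (v x : Mat e) (L : List (Mat e)) → mem x (v +L L) ≡ mem (v +M x) L
mem-translate v x L = does-⇔ to from (∈?-gen _≟M_ x (v +L L)) (∈?-gen _≟M_ (v +M x) L)
  where
  to : x ∈ map (v +M_) L → (v +M x) ∈ L
  to x∈ with ∈-map⁻ (v +M_) x∈
  ... | w , w∈ , refl = subst (_∈ L) (sym (+M-cancel v w)) w∈
  from : (v +M x) ∈ L → x ∈ map (v +M_) L
  from vx∈ = subst (_∈ map (v +M_) L) (+M-cancel v x) (∈-map⁺ (v +M_) vx∈)

E : ℕ → ℕ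
E n = suc (suc n)

2≤E : ∀ n → 2 ≤ E n
2≤E n = s≤s (s≤s z≤n)

inW₁ : ∀ {e} → Mat e → Bool
inW₁ x = allFalse (proj₂ x)

inW₂ : ∀ n → Mat (E n) → Bool
inW₂ n x = not (lookup (proj₁ x) (colE (2≤E n)))
         ∧ allFalse (updateAt (proj₂ x) (colE (2≤E n)) (λ _ → false))

v : ∀ n → Mat (E n)
v n = vMat (E n) (2≤E n)

across : ∀ {e} (S S′ : Mat e → Bool) → Mat e → Mat e → Bool
across S S′ x z = (S x ∧ S′ z) ∨ (S′ x ∧ S z)

across-comm : ∀ {e} (S S′ : Mat e → Bool) x z → across S S′ x z ≡ across S S′ z x
across-comm S S′ x z
  rewrite BP.∧-comm (S x) (S′ z) | BP.∧-comm (S′ x) (S z) = BP.∨-comm (S′ z ∧ S x) (S z ∧ S′ x)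

switched : ∀ n → Mat (E n) → Mat (E n) → Bool
switched n x z =
  across inW₁ (λ y → inW₁ (v n +M y)) x z xor across (inW₂ n) (λ y → inW₂ n (v n +M y)) x z

across-mem : ∀ {e} {S T : List (Mat e)} {s t : Mat e → Bool} →
  (∀ y → mem y S ≡ s y) → (∀ y → mem y T ≡ t y) →
  ∀ x z → (mem x S ∧ mem z T) ∨ (mem x T ∧ mem z S) ≡ across s t x z
across-mem S≡s T≡t x z rewrite S≡s x | S≡s z | T≡t x | T≡t z = refl

adjΓ-switched : ∀ n x z → adjΓ (E n) (2≤E n) x z ≡ adjVO x z xor switched n x z
adjΓ-switched n x z =
  trans (cong₂ (λ p q → (adjVO x z xor p) xor q)
               (across-mem {S = W₁ (E n)} {T = v n +L W₁ (E n)}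
                           (mem-filter (E n) inW₁) translate₁ x z)
               (across-mem {S = W₂ (E n) (2≤E n)} {T = v n +L W₂ (E n) (2≤E n)}
                           (mem-filter (E n) (inW₂ n)) translate₂ x z))
        (BP.xor-assoc (adjVO x z) _ _)
  where
  translate₁ : ∀ y → mem y (v n +L W₁ (E n)) ≡ inW₁ (v n +M y)
  translate₁ y = trans (mem-translate (v n) y (W₁ (E n))) (mem-filter (E n) inW₁ (v n +M y))
  translate₂ : ∀ y → mem y (v n +L W₂ (E n) (2≤E n)) ≡ inW₂ n (v n +M y)
  translate₂ y = trans (mem-translate (v n) y (W₂ (E n) (2≤E n))) (mem-filter (E n) (inW₂ n) (v n +M y))

-- Splitting a matrix of size 2 × (n + 2) into its first n columns (the prefix)
-- and its last two columns (the suffix), where W₁, W₂ and v live.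
suffix : ∀ n → Mat (E n) → Mat 2
suffix zero    x                 = x
suffix (suc n) (a ∷ as , b ∷ bs) = suffix n (as , bs)

prefixZero : ∀ n → Mat (E n) → Bool
prefixZero zero    _                 = true
prefixZero (suc n) (a ∷ as , b ∷ bs) = not b ∧ prefixZero n (as , bs)

prefixQ : ∀ n → Mat (E n) → Mat (E n) → Bool
prefixQ zero    _                 _                 = false
prefixQ (suc n) (a ∷ as , b ∷ bs) (c ∷ cs , d ∷ ds) =
  ((a xor c) ∧ (b xor d)) xor prefixQ n (as , bs) (cs , ds)

Q-split : ∀ n x z → Q (x +M z) ≡ prefixQ n x z xor Q (suffix n x +M suffix n z)
Q-split zero    x                 z                 = refl
Q-split (suc n) (a ∷ as , b ∷ bs) (c ∷ cs , d ∷ ds) =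
  trans (cong (((a xor c) ∧ (b xor d)) xor_) (Q-split n (as , bs) (cs , ds)))
        (sym (BP.xor-assoc ((a xor c) ∧ (b xor d)) _ _))

inW₁-split : ∀ n x → inW₁ x ≡ prefixZero n x ∧ inW₁ (suffix n x)
inW₁-split zero    x                 = refl
inW₁-split (suc n) (a ∷ as , b ∷ bs) =
  trans (cong (not b ∧_) (inW₁-split n (as , bs))) (sym (BP.∧-assoc (not b) _ _))

prefixQ-vanishes : ∀ n x z → prefixZero n x ≡ true → prefixZero n z ≡ true → prefixQ n x z ≡ false
prefixQ-vanishes zero    x                     z                     _  _  = refl
prefixQ-vanishes (suc n) (a ∷ as , false ∷ bs) (c ∷ cs , false ∷ ds) px pz
  rewrite BP.∧-zeroʳ (a xor c) = prefixQ-vanishes n (as , bs) (cs , ds) px pz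

inW₂-cons : ∀ n a b as bs → inW₂ (suc n) (a ∷ as , b ∷ bs) ≡ not b ∧ inW₂ n (as , bs)
inW₂-cons n a false as bs = refl
inW₂-cons n a true  as bs = BP.∧-zeroʳ _

across-gated : ∀ p q s s′ t t′ →
  ((p ∧ s) ∧ (q ∧ t′)) ∨ ((p ∧ s′) ∧ (q ∧ t)) ≡ p ∧ (q ∧ ((s ∧ t′) ∨ (s′ ∧ t)))
across-gated false q     s s′ t t′ = refl
across-gated true  true  s s′ t t′ = refl
across-gated true  false s s′ t t′ rewrite BP.∧-zeroʳ s | BP.∧-zeroʳ s′ = refl

xor-gated : ∀ p q s t → (p ∧ (q ∧ s)) xor (p ∧ (q ∧ t)) ≡ p ∧ (q ∧ (s xor t))
xor-gated false q     s t = refl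
xor-gated true  false s t = refl
xor-gated true  true  s t = refl

switched-cons : ∀ n a b as bs c d cs ds →
  switched (suc n) (a ∷ as , b ∷ bs) (c ∷ cs , d ∷ ds)
  ≡ not b ∧ (not d ∧ switched n (as , bs) (cs , ds))
switched-cons n a b as bs c d cs ds
  rewrite inW₂-cons n a b as bs | inW₂-cons n c d cs ds
        | inW₂-cons n a b (proj₁ (v n +M (as , bs))) (proj₂ (v n +M (as , bs)))
        | inW₂-cons n c d (proj₁ (v n +M (cs , ds))) (proj₂ (v n +M (cs , ds)))
        | across-gated (not b) (not d) (inW₁ (as , bs)) (inW₁ (v n +M (as , bs)))
                                       (inW₁ (cs , ds)) (inW₁ (v n +M (cs , ds)))
        | across-gated (not b) (not d) (inW₂ n (as , bs)) (inW₂ n (v n +M (as , bs)))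
                                       (inW₂ n (cs , ds)) (inW₂ n (v n +M (cs , ds)))
  = xor-gated (not b) (not d) _ _

∧-interchange : ∀ p q r s t → p ∧ (q ∧ (r ∧ (s ∧ t))) ≡ (p ∧ r) ∧ ((q ∧ s) ∧ t)
∧-interchange false q     r     s t = refl
∧-interchange true  false false s t = refl
∧-interchange true  false true  s t = refl
∧-interchange true  true  r     s t = refl

switched-split : ∀ n x z →
  switched n x z ≡ prefixZero n x ∧ (prefixZero n z ∧ switched 0 (suffix n x) (suffix n z))
switched-split zero    x                 z                 = refl
switched-split (suc n) (a ∷ as , b ∷ bs) (c ∷ cs , d ∷ ds) =
  trans (switched-cons n a b as bs c d cs ds)
  (trans (cong (λ t → not b ∧ (not d ∧ t)) (switched-split n (as , bs) (cs , ds)))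
         (∧-interchange (not b) (not d) (prefixZero n (as , bs)) (prefixZero n (cs , ds)) _))

switched-irreflexive : ∀ n x → switched n x x ≡ false
switched-irreflexive n x
  rewrite switched-split n x x
        | not≡true (allMat-sound 2 (λ u → not (switched 0 u u)) refl (suffix n x))
  = trans (cong (prefixZero n x ∧_) (BP.∧-zeroʳ (prefixZero n x))) (BP.∧-zeroʳ (prefixZero n x))

Qˢ : ∀ n → Mat (E n) → Mat (E n) → Bool
Qˢ n x z = Q (x +M z) xor switched n x z

adjΓ-char : ∀ n x z → adjΓ (E n) (2≤E n) x z ≡ not ⌊ x ≟M z ⌋ ∧ not (Qˢ n x z)
adjΓ-char n x z rewrite adjΓ-switched n x z with x ≟M z
... | yes refl rewrite switched-irreflexive n x = refl
... | no  _    = sym (BP.not-distribˡ-xor (Q (x +M z)) (switched n x z))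

Qˢ-irreflexive : ∀ n x → Qˢ n x x ≡ false
Qˢ-irreflexive n x rewrite Q-self x = switched-irreflexive n x

Qˢ-comm : ∀ n x z → Qˢ n x z ≡ Qˢ n z x
Qˢ-comm n x z =
  cong₂ _xor_ (Q-comm x z)
        (cong₂ _xor_ (across-comm inW₁ (λ y → inW₁ (v n +M y)) x z)
                     (across-comm (inW₂ n) (λ y → inW₂ n (v n +M y)) x z))

Qˢ₂ : Bool → Mat 2 → Mat 2 → Bool
Qˢ₂ B u w = Q (u +M w) xor (B ∧ switched 0 u w)

bothPrefixZero : ∀ n → Mat (E n) → Mat (E n) → Bool
bothPrefixZero n x y = prefixZero n x ∧ prefixZero n y

Qˢ-split : ∀ n x y →
  Qˢ n x y ≡ prefixQ n x y xor Qˢ₂ (bothPrefixZero n x y) (suffix n x) (suffix n y)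
Qˢ-split n x y
  rewrite Q-split n x y | switched-split n x y
        | BP.∧-assoc (prefixZero n x) (prefixZero n y) (switched 0 (suffix n x) (suffix n y))
  = BP.xor-assoc (prefixQ n x y) (Q (suffix n x +M suffix n y)) _

prefixQ-inactive : ∀ n x y → bothPrefixZero n x y ∧ prefixQ n x y ≡ false
prefixQ-inactive n x y with prefixZero n x in px | prefixZero n y in py
... | true  | true  rewrite prefixQ-vanishes n x y px py = refl
... | true  | false = refl
... | false | _     = refl

sg : Bool → ℤ
sg false = + 1
sg true  = -ℤ (+ 1)

sg-xor : ∀ a b → sg (a xor b) ≡ sg a *ℤ sg b
sg-xor false false = refl
sg-xor false true  = refl
sg-xor true  false = refl
sg-xor true  true  = refl

σ : ∀ {e} → Mat e → Mat e → ℤ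
σ x z = sg (Q (x +M z))

ω : ∀ n → Mat (E n) → Mat (E n) → ℤ
ω n x z = ind (switched n x z)

χ : ∀ {e} → Mat e → ℤ
χ z = ind (inW₁ z)

-- The indicator of the closed neighbourhood of x (z = x or z adjacent to x), and
-- its expression through the characters:  2·nbr = 1 + σ (1 - 2 ω).
nbr : ∀ n → Mat (E n) → Mat (E n) → ℤ
nbr n x z = ind (not (Qˢ n x z))

nbr-characters : ∀ n x z → + 2 *ℤ nbr n x z ≡ + 1 +ℤ σ x z *ℤ (+ 1 +ℤ -ℤ (+ 2) *ℤ ω n x z)
nbr-characters n x z = table (Q (x +M z)) (switched n x z)
  where
  table : ∀ q s → + 2 *ℤ ind (not (q xor s)) ≡ + 1 +ℤ sg q *ℤ (+ 1 +ℤ -ℤ (+ 2) *ℤ ind s)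
  table false false = refl
  table false true  = refl
  table true  false = refl
  table true  true  = refl

-- A monomial in σ(x,·), σ(y,·), ω(x,·), ω(y,·) and χ: each flag says whether
-- the corresponding factor occurs.
data Monomial : Set where
  mono : (σx σy ωx ωy χz : Bool) → Monomial

opt : Bool → ℤ → ℤ
opt false _ = + 1
opt true  a = a

opt-* : ∀ f a b → opt f (a *ℤ b) ≡ opt f a *ℤ opt f b
opt-* false a b = refl
opt-* true  a b = refl

term : ∀ n → Monomial → Mat (E n) → Mat (E n) → Mat (E n) → ℤ
term n (mono i j k l m) x y z =
  opt i (σ x z) *ℤ (opt j (σ y z) *ℤ (opt k (ω n x z) *ℤ (opt l (ω n y z) *ℤ opt m (χ z))))

columnTerm : Monomial → Bool → Bool → Bool → Bool → Bool → Bool → ℤ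
columnTerm (mono i j k l m) a b c d a′ b′ =
  opt i (sg ((a xor a′) ∧ (b xor b′))) *ℤ (opt j (sg ((c xor a′) ∧ (d xor b′))) *ℤ
  (opt k (ind (not b) *ℤ ind (not b′)) *ℤ (opt l (ind (not d) *ℤ ind (not b′)) *ℤ opt m (ind (not b′)))))

columnFactor : Monomial → Bool → Bool → Bool → Bool → ℤ
columnFactor μ a b c d = colSum (columnTerm μ a b c d)

prefixFactor : ∀ n → Monomial → Mat (E n) → Mat (E n) → ℤ
prefixFactor zero    μ _                 _                 = + 1
prefixFactor (suc n) μ (a ∷ as , b ∷ bs) (c ∷ cs , d ∷ ds) =
  columnFactor μ a b c d *ℤ prefixFactor n μ (as , bs) (cs , ds)

ω-cons : ∀ n a b as bs a′ b′ zs ws →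
  ω (suc n) (a ∷ as , b ∷ bs) (a′ ∷ zs , b′ ∷ ws) ≡ (ind (not b) *ℤ ind (not b′)) *ℤ ω n (as , bs) (zs , ws)
ω-cons n a b as bs a′ b′ zs ws =
  trans (cong ind (switched-cons n a b as bs a′ b′ zs ws))
  (trans (ind-∧ (not b) _)
  (trans (cong (ind (not b) *ℤ_) (ind-∧ (not b′) _)) (sym (ℤP.*-assoc (ind (not b)) _ _))))

term-cons : ∀ n μ a b as bs c d cs ds a′ b′ zs ws →
  term (suc n) μ (a ∷ as , b ∷ bs) (c ∷ cs , d ∷ ds) (a′ ∷ zs , b′ ∷ ws)
  ≡ columnTerm μ a b c d a′ b′ *ℤ term n μ (as , bs) (cs , ds) (zs , ws)
term-cons n (mono i j k l m) a b as bs c d cs ds a′ b′ zs ws =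
  trans (cong₅ (cong (opt i) (sg-xor hx (Q ((as , bs) +M (zs , ws)))))
               (cong (opt j) (sg-xor hy (Q ((cs , ds) +M (zs , ws)))))
               (cong (opt k) (ω-cons n a b as bs a′ b′ zs ws))
               (cong (opt l) (ω-cons n c d cs ds a′ b′ zs ws))
               (cong (opt m) (ind-∧ (not b′) (inW₁ (zs , ws)))))
  (trans (cong₅ (opt-* i (sg hx) (σ x′ z′)) (opt-* j (sg hy) (σ y′ z′))
                (opt-* k (ind (not b) *ℤ ind (not b′)) (ω n x′ z′))
                (opt-* l (ind (not d) *ℤ ind (not b′)) (ω n y′ z′)) (opt-* m (ind (not b′)) (χ z′)))
         (regroup (opt i (sg hx)) (opt i (σ x′ z′)) (opt j (sg hy)) (opt j (σ y′ z′))
                  (opt k (ind (not b) *ℤ ind (not b′))) (opt k (ω n x′ z′))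
                  (opt l (ind (not d) *ℤ ind (not b′))) (opt l (ω n y′ z′))
                  (opt m (ind (not b′))) (opt m (χ z′))))
  where
  x′ = (as , bs)
  y′ = (cs , ds)
  z′ = (zs , ws)
  hx = (a xor a′) ∧ (b xor b′)
  hy = (c xor a′) ∧ (d xor b′)
  product5 : ℤ → ℤ → ℤ → ℤ → ℤ → ℤ
  product5 p q r s t = p *ℤ (q *ℤ (r *ℤ (s *ℤ t)))
  cong₅ : ∀ {p p′ q q′ r r′ s s′ t t′} → p ≡ p′ → q ≡ q′ → r ≡ r′ → s ≡ s′ → t ≡ t′ →
    product5 p q r s t ≡ product5 p′ q′ r′ s′ t′
  cong₅ refl refl refl refl refl = refl
  regroup : ∀ p p′ q q′ r r′ s s′ t t′ →
    (p *ℤ p′) *ℤ ((q *ℤ q′) *ℤ ((r *ℤ r′) *ℤ ((s *ℤ s′) *ℤ (t *ℤ t′))))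
    ≡ (p *ℤ (q *ℤ (r *ℤ (s *ℤ t)))) *ℤ (p′ *ℤ (q′ *ℤ (r′ *ℤ (s′ *ℤ t′))))
  regroup = solve-∀

ΣMat-term : ∀ n μ x y →
  ΣMat (E n) (term n μ x y) ≡ prefixFactor n μ x y *ℤ ΣMat 2 (term 0 μ (suffix n x) (suffix n y))
ΣMat-term zero    μ x y = sym (ℤP.*-identityˡ _)
ΣMat-term (suc n) μ (a ∷ as , b ∷ bs) (c ∷ cs , d ∷ ds) =
  trans (ΣMat-factor (E n) (term (suc n) μ (a ∷ as , b ∷ bs) (c ∷ cs , d ∷ ds))
                     (columnTerm μ a b c d) (term n μ (as , bs) (cs , ds))
                     (λ a′ b′ zs ws → term-cons n μ a b as bs c d cs ds a′ b′ zs ws))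
  (trans (cong (columnFactor μ a b c d *ℤ_) (ΣMat-term n μ (as , bs) (cs , ds)))
         (sym (ℤP.*-assoc (columnFactor μ a b c d) _ _)))

prefixGate : (Bool → Bool → Bool) → ∀ n → Mat (E n) → Mat (E n) → Bool
prefixGate g zero    _                 _                 = true
prefixGate g (suc n) (a ∷ as , b ∷ bs) (c ∷ cs , d ∷ ds) = g b d ∧ prefixGate g n (as , bs) (cs , ds)

prefixFactor-gated : ∀ μ (g : Bool → Bool → Bool) →
  (∀ a b c d → columnFactor μ a b c d ≡ + 2 *ℤ ind (g b d)) →
  ∀ n x y → prefixFactor n μ x y ≡ + (2 ^ n) *ℤ ind (prefixGate g n x y)
prefixFactor-gated μ g col zero    x                 y                 = refl
prefixFactor-gated μ g col (suc n) (a ∷ as , b ∷ bs) (c ∷ cs , d ∷ ds) =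
  trans (cong₂ _*ℤ_ (col a b c d) (prefixFactor-gated μ g col n (as , bs) (cs , ds)))
  (trans (interchange (+ 2) (ind (g b d)) (+ (2 ^ n)) (ind (prefixGate g n (as , bs) (cs , ds))))
         (sym (cong₂ _*ℤ_ (ℤP.pos-* 2 (2 ^ n)) (ind-∧ (g b d) _))))
  where
  interchange : ∀ p q r s → (p *ℤ q) *ℤ (r *ℤ s) ≡ (p *ℤ r) *ℤ (q *ℤ s)
  interchange = solve-∀

columnTest : Monomial → (Bool → Bool → Bool) → Vec Bool 4 → Bool
columnTest μ g (a ∷ b ∷ c ∷ d ∷ []) = columnFactor μ a b c d == + 2 *ℤ ind (g b d)

columnCheck : Monomial → (Bool → Bool → Bool) → Bool
columnCheck μ g = allVec 4 (columnTest μ g)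

columnCheck-sound : ∀ μ g → columnCheck μ g ≡ true →
  ∀ a b c d → columnFactor μ a b c d ≡ + 2 *ℤ ind (g b d)
columnCheck-sound μ g check a b c d =
  ==-sound _ _ (allVec-sound 4 (columnTest μ g) check (a ∷ b ∷ c ∷ d ∷ []))

gate-open : ∀ n x y → prefixGate (λ _ _ → true) n x y ≡ true
gate-open zero    x                 y                 = refl
gate-open (suc n) (a ∷ as , b ∷ bs) (c ∷ cs , d ∷ ds) = gate-open n (as , bs) (cs , ds)

gate-x : ∀ n x y → prefixGate (λ b _ → not b) n x y ≡ prefixZero n x
gate-x zero    x                 y                 = refl
gate-x (suc n) (a ∷ as , b ∷ bs) (c ∷ cs , d ∷ ds) = cong (not b ∧_) (gate-x n (as , bs) (cs , ds))

gate-xy : ∀ n x y → prefixGate (λ b d → not b ∧ not d) n x y ≡ bothPrefixZero n x y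
gate-xy zero    x                 y                 = refl
gate-xy (suc n) (a ∷ as , b ∷ bs) (c ∷ cs , d ∷ ds) =
  trans (cong ((not b ∧ not d) ∧_) (gate-xy n (as , bs) (cs , ds)))
        (interchange (not b) (not d) (prefixZero n (as , bs)) (prefixZero n (cs , ds)))
  where
  interchange : ∀ p q r s → (p ∧ q) ∧ (r ∧ s) ≡ (p ∧ r) ∧ (q ∧ s)
  interchange false q     r     s = refl
  interchange true  false false s = refl
  interchange true  false true  s = refl
  interchange true  true  r     s = refl

-- The monomials that occur (index 1 refers to x, index 2 to y).
unit σ₁ σ₂ σ₁ω₁ σ₂ω₂ σ₁σ₂ σ₁σ₂ω₁ σ₁σ₂ω₂ σ₁σ₂ω₁ω₂ onlyχ σ₁χ σ₁ω₁χ : Monomial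
unit       = mono false false false false false
σ₁         = mono true  false false false false
σ₂         = mono false true  false false false
σ₁ω₁       = mono true  false true  false false
σ₂ω₂       = mono false true  false true  false
σ₁σ₂       = mono true  true  false false false
σ₁σ₂ω₁     = mono true  true  true  false false
σ₁σ₂ω₂     = mono true  true  false true  false
σ₁σ₂ω₁ω₂   = mono true  true  true  true  false
onlyχ      = mono false false false false true
σ₁χ        = mono true  false false false true
σ₁ω₁χ      = mono true  false true  false true

S₂ : Monomial → Mat 2 → Mat 2 → ℤ
S₂ μ u w = ΣMat 2 (term 0 μ u w)

S₂-σ₁ : ∀ u w → S₂ σ₁ u w ≡ + 4
S₂-σ₁ u w = ==-sound _ _ (allPairs-sound (λ u w → S₂ σ₁ u w == + 4) refl u w)

S₂-σ₂ : ∀ u w → S₂ σ₂ u w ≡ + 4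
S₂-σ₂ u w = ==-sound _ _ (allPairs-sound (λ u w → S₂ σ₂ u w == + 4) refl u w)

S₂-σ₁ω₁ : ∀ u w → S₂ σ₁ω₁ u w ≡ + 0
S₂-σ₁ω₁ u w = ==-sound _ _ (allPairs-sound (λ u w → S₂ σ₁ω₁ u w == + 0) refl u w)

S₂-σ₂ω₂ : ∀ u w → S₂ σ₂ω₂ u w ≡ + 0
S₂-σ₂ω₂ u w = ==-sound _ _ (allPairs-sound (λ u w → S₂ σ₂ω₂ u w == + 0) refl u w)

S₂-σ₁σ₂ : ∀ u w → u ≢ w → S₂ σ₁σ₂ u w ≡ + 0
S₂-σ₁σ₂ u w u≢w = ==-sound _ _
  (∨-right (allPairs-sound (λ u w → ⌊ u ≟M w ⌋ ∨ (S₂ σ₁σ₂ u w == + 0)) refl u w) (⌊⌋-false (u ≟M w) u≢w))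

S₂-clique : ∀ u → inW₁ u ≡ false → S₂ σ₁χ u u +ℤ -ℤ (+ 2) *ℤ S₂ σ₁ω₁χ u u ≡ + 0
S₂-clique u u∉W₁ = ==-sound _ _
  (∨-right (allMat-sound 2 (λ u → inW₁ u ∨ (S₂ σ₁χ u u +ℤ -ℤ (+ 2) *ℤ S₂ σ₁ω₁χ u u == + 0)) refl u) u∉W₁)

P : ℕ → ℤ
P n = + (2 ^ n)

2^E : ∀ n → + (2 ^ E n) ≡ + 4 *ℤ P n
2^E n = trans (ℤP.pos-* 2 (2 * 2 ^ n)) (trans (cong (+ 2 *ℤ_) (ℤP.pos-* 2 (2 ^ n))) (quadruple (P n)))
  where
  quadruple : ∀ p → + 2 *ℤ (+ 2 *ℤ p) ≡ + 4 *ℤ p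
  quadruple = solve-∀

ΣVec-χ : ∀ n → ΣVec n (λ b → ind (allFalse b)) ≡ + 1
ΣVec-χ zero    = refl
ΣVec-χ (suc n) = trans (ΣVec-cong n (λ b → ℤP.+-identityʳ (ind (allFalse b)))) (ΣVec-χ n)

ΣMat-χ : ∀ n → ΣMat (E n) χ ≡ + 4 *ℤ P n
ΣMat-χ n =
  trans (ΣVec-cong (E n) (λ _ → ΣVec-χ (E n)))
  (trans (ΣVec-const (E n) (+ 1)) (trans (ℤP.*-identityʳ _) (2^E n)))

ΣMat-one : ∀ n → ΣMat (E n) (λ _ → + 1) ≡ + 16 *ℤ (P n *ℤ P n)
ΣMat-one n =
  trans (ΣMat-const (E n) (+ 1)) (trans (cong (λ q → q *ℤ (q *ℤ + 1)) (2^E n)) (square (P n)))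
  where
  square : ∀ p → (+ 4 *ℤ p) *ℤ ((+ 4 *ℤ p) *ℤ + 1) ≡ + 16 *ℤ (p *ℤ p)
  square = solve-∀

ΣMat-zero : ∀ n → ΣMat n (λ _ → + 0) ≡ + 0
ΣMat-zero n =
  trans (ΣMat-const n (+ 0)) (trans (cong (+ (2 ^ n) *ℤ_) (ℤP.*-zeroʳ (+ (2 ^ n)))) (ℤP.*-zeroʳ (+ (2 ^ n))))

ΣMat-gated : ∀ μ g → columnCheck μ g ≡ true → ∀ n x y →
  ΣMat (E n) (term n μ x y) ≡ (P n *ℤ ind (prefixGate g n x y)) *ℤ S₂ μ (suffix n x) (suffix n y)
ΣMat-gated μ g check n x y =
  trans (ΣMat-term n μ x y)
        (cong (_*ℤ S₂ μ (suffix n x) (suffix n y))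
              (prefixFactor-gated μ g (columnCheck-sound μ g check) n x y))

ΣMat-vanishing : ∀ μ → (∀ u w → S₂ μ u w ≡ + 0) → ∀ n x y → ΣMat (E n) (term n μ x y) ≡ + 0
ΣMat-vanishing μ S₂≡0 n x y =
  trans (ΣMat-term n μ x y)
        (trans (cong (prefixFactor n μ x y *ℤ_) (S₂≡0 _ _)) (ℤP.*-zeroʳ (prefixFactor n μ x y)))

ΣMat-ungated : ∀ μ → columnCheck μ (λ _ _ → true) ≡ true → (∀ u w → S₂ μ u w ≡ + 4) →
  ∀ n x y → ΣMat (E n) (term n μ x y) ≡ + 4 *ℤ P n
ΣMat-ungated μ check S₂≡4 n x y =
  trans (ΣMat-gated μ (λ _ _ → true) check n x y)
  (trans (cong₂ (λ g s → (P n *ℤ ind g) *ℤ s) (gate-open n x y) (S₂≡4 _ _)) (scale (P n)))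
  where
  scale : ∀ p → (p *ℤ + 1) *ℤ + 4 ≡ + 4 *ℤ p
  scale = solve-∀

ΣMat-prefixZero : ∀ μ → columnCheck μ (λ b _ → not b) ≡ true → ∀ n x y →
  ΣMat (E n) (term n μ x y) ≡ (P n *ℤ ind (prefixZero n x)) *ℤ S₂ μ (suffix n x) (suffix n y)
ΣMat-prefixZero μ check n x y =
  trans (ΣMat-gated μ (λ b _ → not b) check n x y)
        (cong (λ g → (P n *ℤ ind g) *ℤ S₂ μ (suffix n x) (suffix n y)) (gate-x n x y))

ΣMat-bothPrefixZero : ∀ μ → columnCheck μ (λ b d → not b ∧ not d) ≡ true → ∀ n x y →
  ΣMat (E n) (term n μ x y) ≡ (P n *ℤ ind (bothPrefixZero n x y)) *ℤ S₂ μ (suffix n x) (suffix n y)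
ΣMat-bothPrefixZero μ check n x y =
  trans (ΣMat-gated μ (λ b d → not b ∧ not d) check n x y)
        (cong (λ g → (P n *ℤ ind g) *ℤ S₂ μ (suffix n x) (suffix n y)) (gate-xy n x y))

-- Σ_z σ(x,z) σ(y,z) = 0 for x ≠ y: some column differs, and a differing prefix
-- column has factor 0, while differing suffixes give a zero suffix sum.
columnFactor-σ₁σ₂ : ∀ a b c d → columnFactor σ₁σ₂ a b c d ≡ + 0 ⊎ (a ≡ c × b ≡ d)
columnFactor-σ₁σ₂ false false false false = inj₂ (refl , refl)
columnFactor-σ₁σ₂ false false false true  = inj₁ refl
columnFactor-σ₁σ₂ false false true  false = inj₁ refl
columnFactor-σ₁σ₂ false false true  true  = inj₁ refl
columnFactor-σ₁σ₂ false true  false false = inj₁ refl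
columnFactor-σ₁σ₂ false true  false true  = inj₂ (refl , refl)
columnFactor-σ₁σ₂ false true  true  false = inj₁ refl
columnFactor-σ₁σ₂ false true  true  true  = inj₁ refl
columnFactor-σ₁σ₂ true  false false false = inj₁ refl
columnFactor-σ₁σ₂ true  false false true  = inj₁ refl
columnFactor-σ₁σ₂ true  false true  false = inj₂ (refl , refl)
columnFactor-σ₁σ₂ true  false true  true  = inj₁ refl
columnFactor-σ₁σ₂ true  true  false false = inj₁ refl
columnFactor-σ₁σ₂ true  true  false true  = inj₁ refl
columnFactor-σ₁σ₂ true  true  true  false = inj₁ refl
columnFactor-σ₁σ₂ true  true  true  true  = inj₂ (refl , refl)

σ₁σ₂-vanishes : ∀ n x y → x ≢ y →
  prefixFactor n σ₁σ₂ x y *ℤ S₂ σ₁σ₂ (suffix n x) (suffix n y) ≡ + 0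
σ₁σ₂-vanishes zero    x y x≢y = trans (ℤP.*-identityˡ _) (S₂-σ₁σ₂ x y x≢y)
σ₁σ₂-vanishes (suc n) (a ∷ as , b ∷ bs) (c ∷ cs , d ∷ ds) x≢y with columnFactor-σ₁σ₂ a b c d
... | inj₁ factor≡0 rewrite factor≡0 = refl
... | inj₂ (refl , refl) =
  trans (ℤP.*-assoc (columnFactor σ₁σ₂ a b a b) _ _)
  (trans (cong (columnFactor σ₁σ₂ a b a b *ℤ_)
               (σ₁σ₂-vanishes n (as , bs) (cs , ds) (λ { refl → x≢y refl })))
         (ℤP.*-zeroʳ (columnFactor σ₁σ₂ a b a b)))

ΣMat-σ₁σ₂ : ∀ n x y → x ≢ y → ΣMat (E n) (term n σ₁σ₂ x y) ≡ + 0
ΣMat-σ₁σ₂ n x y x≢y = trans (ΣMat-term n σ₁σ₂ x y) (σ₁σ₂-vanishes n x y x≢y)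

Poly : Set
Poly = List (ℤ × Monomial)

evalPoly : ∀ n → Poly → Mat (E n) → Mat (E n) → Mat (E n) → ℤ
evalPoly n []            x y z = + 0
evalPoly n ((c , μ) ∷ p) x y z = c *ℤ term n μ x y z +ℤ evalPoly n p x y z

ΣPoly : ∀ n → Poly → Mat (E n) → Mat (E n) → ℤ
ΣPoly n []            x y = + 0
ΣPoly n ((c , μ) ∷ p) x y = c *ℤ ΣMat (E n) (term n μ x y) +ℤ ΣPoly n p x y

ΣMat-poly : ∀ n p x y → ΣMat (E n) (evalPoly n p x y) ≡ ΣPoly n p x y
ΣMat-poly n []            x y = ΣMat-zero (E n)
ΣMat-poly n ((c , μ) ∷ p) x y =
  trans (ΣMat-+ (E n) (λ z → c *ℤ term n μ x y z) (evalPoly n p x y))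
        (cong₂ _+ℤ_ (ΣMat-* (E n) c (term n μ x y)) (ΣMat-poly n p x y))

ΣMat-expand : ∀ n (k : ℤ) (f : Mat (E n) → ℤ) p x y →
  (∀ z → k *ℤ f z ≡ evalPoly n p x y z) → k *ℤ ΣMat (E n) f ≡ ΣPoly n p x y
ΣMat-expand n k f p x y expansion =
  trans (sym (ΣMat-* (E n) k f)) (trans (ΣMat-cong (E n) expansion) (ΣMat-poly n p x y))

-- The suffix contribution to the number of common neighbours of x and y; the
-- switching enters only when both prefixes have zero second row (B).
coef : Bool → Mat 2 → Mat 2 → ℤ
coef B u w =
  + 8 +ℤ ind B *ℤ (-ℤ (+ 2) *ℤ S₂ σ₁σ₂ω₁ u w +ℤ (-ℤ (+ 2) *ℤ S₂ σ₁σ₂ω₂ u w +ℤ + 4 *ℤ S₂ σ₁σ₂ω₁ω₂ u w))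

-- 4·nbr(x,z)·nbr(y,z) = (1 + σ₁(1 - 2ω₁)) (1 + σ₂(1 - 2ω₂)), multiplied out.
common-poly : Poly
common-poly =
  (+ 1 , unit) ∷ (+ 1 , σ₁) ∷ (+ 1 , σ₂) ∷ (-ℤ (+ 2) , σ₁ω₁) ∷ (-ℤ (+ 2) , σ₂ω₂) ∷ (+ 1 , σ₁σ₂) ∷
  (-ℤ (+ 2) , σ₁σ₂ω₁) ∷ (-ℤ (+ 2) , σ₁σ₂ω₂) ∷ (+ 4 , σ₁σ₂ω₁ω₂) ∷ []

common-expansion : ∀ n x y z → + 4 *ℤ (nbr n x z *ℤ nbr n y z) ≡ evalPoly n common-poly x y z
common-expansion n x y z =
  trans (split (nbr n x z) (nbr n y z))
  (trans (cong₂ _*ℤ_ (nbr-characters n x z) (nbr-characters n y z))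
         (multiply-out (σ x z) (σ y z) (ω n x z) (ω n y z)))
  where
  split : ∀ a b → + 4 *ℤ (a *ℤ b) ≡ (+ 2 *ℤ a) *ℤ (+ 2 *ℤ b)
  split = solve-∀
  multiply-out : ∀ s₁ s₂ w₁ w₂ →
    (+ 1 +ℤ s₁ *ℤ (+ 1 +ℤ -ℤ (+ 2) *ℤ w₁)) *ℤ (+ 1 +ℤ s₂ *ℤ (+ 1 +ℤ -ℤ (+ 2) *ℤ w₂)) ≡
    + 1 *ℤ (+ 1 *ℤ (+ 1 *ℤ (+ 1 *ℤ (+ 1 *ℤ + 1)))) +ℤ
    (+ 1 *ℤ (s₁ *ℤ (+ 1 *ℤ (+ 1 *ℤ (+ 1 *ℤ + 1)))) +ℤ
    (+ 1 *ℤ (+ 1 *ℤ (s₂ *ℤ (+ 1 *ℤ (+ 1 *ℤ + 1)))) +ℤ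
    (-ℤ (+ 2) *ℤ (s₁ *ℤ (+ 1 *ℤ (w₁ *ℤ (+ 1 *ℤ + 1)))) +ℤ
    (-ℤ (+ 2) *ℤ (+ 1 *ℤ (s₂ *ℤ (+ 1 *ℤ (w₂ *ℤ + 1)))) +ℤ
    (+ 1 *ℤ (s₁ *ℤ (s₂ *ℤ (+ 1 *ℤ (+ 1 *ℤ + 1)))) +ℤ
    (-ℤ (+ 2) *ℤ (s₁ *ℤ (s₂ *ℤ (w₁ *ℤ (+ 1 *ℤ + 1)))) +ℤ
    (-ℤ (+ 2) *ℤ (s₁ *ℤ (s₂ *ℤ (+ 1 *ℤ (w₂ *ℤ + 1)))) +ℤ
    (+ 4 *ℤ (s₁ *ℤ (s₂ *ℤ (w₁ *ℤ (w₂ *ℤ + 1)))) +ℤ + 0))))))))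
  multiply-out = solve-∀

common-sum : ∀ n x y → x ≢ y →
  + 4 *ℤ ΣMat (E n) (λ z → nbr n x z *ℤ nbr n y z)
  ≡ + 16 *ℤ (P n *ℤ P n) +ℤ P n *ℤ coef (bothPrefixZero n x y) (suffix n x) (suffix n y)
common-sum n x y x≢y =
  trans (ΣMat-expand n (+ 4) (λ z → nbr n x z *ℤ nbr n y z) common-poly x y (common-expansion n x y))
        combine
  where
  u = suffix n x
  w = suffix n y
  combine : ΣPoly n common-poly x y
    ≡ + 16 *ℤ (P n *ℤ P n) +ℤ P n *ℤ coef (bothPrefixZero n x y) u w
  combine =
    collect (ΣMat-one n) (ΣMat-ungated σ₁ refl S₂-σ₁ n x y) (ΣMat-ungated σ₂ refl S₂-σ₂ n x y)
            (ΣMat-vanishing σ₁ω₁ S₂-σ₁ω₁ n x y) (ΣMat-vanishing σ₂ω₂ S₂-σ₂ω₂ n x y) (ΣMat-σ₁σ₂ n x y x≢y)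
            (ΣMat-bothPrefixZero σ₁σ₂ω₁ refl n x y) (ΣMat-bothPrefixZero σ₁σ₂ω₂ refl n x y)
            (ΣMat-bothPrefixZero σ₁σ₂ω₁ω₂ refl n x y)
    where
    p = P n
    b = ind (bothPrefixZero n x y)
    s₁ = S₂ σ₁σ₂ω₁ u w
    s₂ = S₂ σ₁σ₂ω₂ u w
    s₃ = S₂ σ₁σ₂ω₁ω₂ u w
    identity : ∀ p b s₁ s₂ s₃ →
      + 1 *ℤ (+ 16 *ℤ (p *ℤ p)) +ℤ (+ 1 *ℤ (+ 4 *ℤ p) +ℤ (+ 1 *ℤ (+ 4 *ℤ p) +ℤ
      (-ℤ (+ 2) *ℤ + 0 +ℤ (-ℤ (+ 2) *ℤ + 0 +ℤ (+ 1 *ℤ + 0 +ℤ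
      (-ℤ (+ 2) *ℤ ((p *ℤ b) *ℤ s₁) +ℤ (-ℤ (+ 2) *ℤ ((p *ℤ b) *ℤ s₂) +ℤ
      (+ 4 *ℤ ((p *ℤ b) *ℤ s₃) +ℤ + 0))))))))
      ≡ + 16 *ℤ (p *ℤ p) +ℤ p *ℤ (+ 8 +ℤ b *ℤ (-ℤ (+ 2) *ℤ s₁ +ℤ (-ℤ (+ 2) *ℤ s₂ +ℤ + 4 *ℤ s₃)))
    identity = solve-∀
    collect : ∀ {A₁ A₂ A₃ A₄ A₅ A₆ A₇ A₈ A₉} →
      A₁ ≡ + 16 *ℤ (p *ℤ p) → A₂ ≡ + 4 *ℤ p → A₃ ≡ + 4 *ℤ p → A₄ ≡ + 0 → A₅ ≡ + 0 → A₆ ≡ + 0 →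
      A₇ ≡ (p *ℤ b) *ℤ s₁ → A₈ ≡ (p *ℤ b) *ℤ s₂ → A₉ ≡ (p *ℤ b) *ℤ s₃ →
      + 1 *ℤ A₁ +ℤ (+ 1 *ℤ A₂ +ℤ (+ 1 *ℤ A₃ +ℤ (-ℤ (+ 2) *ℤ A₄ +ℤ (-ℤ (+ 2) *ℤ A₅ +ℤ (+ 1 *ℤ A₆ +ℤ
      (-ℤ (+ 2) *ℤ A₇ +ℤ (-ℤ (+ 2) *ℤ A₈ +ℤ (+ 4 *ℤ A₉ +ℤ + 0))))))))
      ≡ + 16 *ℤ (p *ℤ p) +ℤ p *ℤ coef (bothPrefixZero n x y) u w
    collect refl refl refl refl refl refl refl refl refl = identity p b s₁ s₂ s₃

-- 2·nbr(x,z) = 1 + σ₁(1 - 2ω₁), multiplied out.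
degree-poly : Poly
degree-poly = (+ 1 , unit) ∷ (+ 1 , σ₁) ∷ (-ℤ (+ 2) , σ₁ω₁) ∷ []

degree-expansion : ∀ n x z → + 2 *ℤ nbr n x z ≡ evalPoly n degree-poly x x z
degree-expansion n x z = trans (nbr-characters n x z) (multiply-out (σ x z) (ω n x z))
  where
  multiply-out : ∀ s w → + 1 +ℤ s *ℤ (+ 1 +ℤ -ℤ (+ 2) *ℤ w) ≡
    + 1 *ℤ (+ 1 *ℤ (+ 1 *ℤ (+ 1 *ℤ (+ 1 *ℤ + 1)))) +ℤ (+ 1 *ℤ (s *ℤ (+ 1 *ℤ (+ 1 *ℤ (+ 1 *ℤ + 1)))) +ℤ
    (-ℤ (+ 2) *ℤ (s *ℤ (+ 1 *ℤ (w *ℤ (+ 1 *ℤ + 1)))) +ℤ + 0))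
  multiply-out = solve-∀

degree-sum : ∀ n x → + 2 *ℤ ΣMat (E n) (nbr n x) ≡ + 16 *ℤ (P n *ℤ P n) +ℤ + 4 *ℤ P n
degree-sum n x =
  trans (ΣMat-expand n (+ 2) (nbr n x) degree-poly x x (degree-expansion n x))
        (collect (ΣMat-one n) (ΣMat-ungated σ₁ refl S₂-σ₁ n x x) (ΣMat-vanishing σ₁ω₁ S₂-σ₁ω₁ n x x))
  where
  p = P n
  identity : ∀ p → + 1 *ℤ (+ 16 *ℤ (p *ℤ p)) +ℤ (+ 1 *ℤ (+ 4 *ℤ p) +ℤ (-ℤ (+ 2) *ℤ + 0 +ℤ + 0))
                   ≡ + 16 *ℤ (p *ℤ p) +ℤ + 4 *ℤ p
  identity = solve-∀
  collect : ∀ {A₁ A₂ A₃} → A₁ ≡ + 16 *ℤ (p *ℤ p) → A₂ ≡ + 4 *ℤ p → A₃ ≡ + 0 →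
    + 1 *ℤ A₁ +ℤ (+ 1 *ℤ A₂ +ℤ (-ℤ (+ 2) *ℤ A₃ +ℤ + 0)) ≡ + 16 *ℤ (p *ℤ p) +ℤ + 4 *ℤ p
  collect refl refl refl = identity p

-- 2·nbr(x,z)·χ(z) = (1 + σ₁(1 - 2ω₁)) χ, multiplied out.
clique-poly : Poly
clique-poly = (+ 1 , onlyχ) ∷ (+ 1 , σ₁χ) ∷ (-ℤ (+ 2) , σ₁ω₁χ) ∷ []

clique-expansion : ∀ n x z → + 2 *ℤ (nbr n x z *ℤ χ z) ≡ evalPoly n clique-poly x x z
clique-expansion n x z =
  trans (sym (ℤP.*-assoc (+ 2) (nbr n x z) (χ z)))
  (trans (cong (_*ℤ χ z) (nbr-characters n x z)) (multiply-out (σ x z) (ω n x z) (χ z)))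
  where
  multiply-out : ∀ s w c → (+ 1 +ℤ s *ℤ (+ 1 +ℤ -ℤ (+ 2) *ℤ w)) *ℤ c ≡
    + 1 *ℤ (+ 1 *ℤ (+ 1 *ℤ (+ 1 *ℤ (+ 1 *ℤ c)))) +ℤ (+ 1 *ℤ (s *ℤ (+ 1 *ℤ (+ 1 *ℤ (+ 1 *ℤ c)))) +ℤ
    (-ℤ (+ 2) *ℤ (s *ℤ (+ 1 *ℤ (w *ℤ (+ 1 *ℤ c)))) +ℤ + 0))
  multiply-out = solve-∀

ΣMat-onlyχ : ∀ n x y → ΣMat (E n) (term n onlyχ x y) ≡ + 4 *ℤ P n
ΣMat-onlyχ n x y = trans (ΣMat-cong (E n) (λ z → ones (χ z))) (ΣMat-χ n)
  where
  ones : ∀ c → + 1 *ℤ (+ 1 *ℤ (+ 1 *ℤ (+ 1 *ℤ c))) ≡ c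
  ones = solve-∀

clique-suffix : ∀ n x → inW₁ x ≡ false →
  ind (prefixZero n x) *ℤ (S₂ σ₁χ (suffix n x) (suffix n x) +ℤ -ℤ (+ 2) *ℤ S₂ σ₁ω₁χ (suffix n x) (suffix n x))
  ≡ + 0
clique-suffix n x x∉W₁ with prefixZero n x in px
... | false = refl
... | true  = trans (ℤP.*-identityˡ _) (S₂-clique (suffix n x) (trans (sym (cong (_∧ inW₁ (suffix n x)) px))
                                                               (trans (sym (inW₁-split n x)) x∉W₁)))

clique-sum : ∀ n x → inW₁ x ≡ false → + 2 *ℤ ΣMat (E n) (λ z → nbr n x z *ℤ χ z) ≡ + 4 *ℤ P n
clique-sum n x x∉W₁ =
  trans (ΣMat-expand n (+ 2) (λ z → nbr n x z *ℤ χ z) clique-poly x x (clique-expansion n x))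
        (collect (ΣMat-onlyχ n x x) (ΣMat-prefixZero σ₁χ refl n x x) (ΣMat-prefixZero σ₁ω₁χ refl n x x)
                 (clique-suffix n x x∉W₁))
  where
  p = P n
  u = suffix n x
  b = ind (prefixZero n x)
  identity : ∀ p b s s′ →
    + 1 *ℤ (+ 4 *ℤ p) +ℤ (+ 1 *ℤ ((p *ℤ b) *ℤ s) +ℤ (-ℤ (+ 2) *ℤ ((p *ℤ b) *ℤ s′) +ℤ + 0))
    ≡ + 4 *ℤ p +ℤ p *ℤ (b *ℤ (s +ℤ -ℤ (+ 2) *ℤ s′))
  identity = solve-∀
  collect : ∀ {A₁ A₂ A₃} → A₁ ≡ + 4 *ℤ p → A₂ ≡ (p *ℤ b) *ℤ S₂ σ₁χ u u → A₃ ≡ (p *ℤ b) *ℤ S₂ σ₁ω₁χ u u →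
    b *ℤ (S₂ σ₁χ u u +ℤ -ℤ (+ 2) *ℤ S₂ σ₁ω₁χ u u) ≡ + 0 →
    + 1 *ℤ A₁ +ℤ (+ 1 *ℤ A₂ +ℤ (-ℤ (+ 2) *ℤ A₃ +ℤ + 0)) ≡ + 4 *ℤ p
  collect refl refl refl vanish =
    trans (identity p b (S₂ σ₁χ u u) (S₂ σ₁ω₁χ u u))
          (trans (cong (λ t → + 4 *ℤ p +ℤ p *ℤ t) vanish)
                 (trans (cong (+ 4 *ℤ p +ℤ_) (ℤP.*-zeroʳ p)) (ℤP.+-identityʳ (+ 4 *ℤ p))))

ind-adjΓ : ∀ n x z → ind (adjΓ (E n) (2≤E n) x z) ≡ (+ 1 +ℤ -ℤ ind ⌊ x ≟M z ⌋) *ℤ nbr n x z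
ind-adjΓ n x z =
  trans (cong ind (adjΓ-char n x z))
  (trans (ind-∧ (not ⌊ x ≟M z ⌋) _) (cong (_*ℤ nbr n x z) (ind-not ⌊ x ≟M z ⌋)))
  where
  ind-not : ∀ b → ind (not b) ≡ + 1 +ℤ -ℤ ind b
  ind-not false = refl
  ind-not true  = refl

ΣMat-punctured : ∀ n (x : Mat n) (g : Mat n → ℤ) →
  ΣMat n (λ z → (+ 1 +ℤ -ℤ ind ⌊ x ≟M z ⌋) *ℤ g z) ≡ ΣMat n g +ℤ -ℤ g x
ΣMat-punctured n x g =
  trans (ΣMat-cong n (λ z → distribute (ind ⌊ x ≟M z ⌋) (g z)))
  (trans (ΣMat-+ n g (λ z → -ℤ (+ 1) *ℤ (ind ⌊ x ≟M z ⌋ *ℤ g z)))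
  (trans (cong (ΣMat n g +ℤ_) (ΣMat-* n (-ℤ (+ 1)) (λ z → ind ⌊ x ≟M z ⌋ *ℤ g z)))
  (trans (cong (λ t → ΣMat n g +ℤ -ℤ (+ 1) *ℤ t) (ΣMat-δ n x g))
         (cong (ΣMat n g +ℤ_) (ℤP.-1*i≡-i (g x))))))
  where
  distribute : ∀ d a → (+ 1 +ℤ -ℤ d) *ℤ a ≡ a +ℤ -ℤ (+ 1) *ℤ (d *ℤ a)
  distribute = solve-∀

nbr-self : ∀ n x → nbr n x x ≡ + 1
nbr-self n x = cong (λ b → ind (not b)) (Qˢ-irreflexive n x)

nbr-comm : ∀ n x y → nbr n x y ≡ nbr n y x
nbr-comm n x y = cong (λ b → ind (not b)) (Qˢ-comm n x y)

degree-count : ∀ n x →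
  + degree (allMats (E n)) (adjΓ (E n) (2≤E n)) x ≡ ΣMat (E n) (nbr n x) +ℤ -ℤ (+ 1)
degree-count n x =
  trans (count-allMats (E n) (adjΓ (E n) (2≤E n) x))
  (trans (ΣMat-cong (E n) (ind-adjΓ n x))
  (trans (ΣMat-punctured (E n) x (nbr n x)) (cong (λ t → ΣMat (E n) (nbr n x) +ℤ -ℤ t) (nbr-self n x))))

-- Common neighbours of distinct x, y: the common closed neighbours, minus x and y
-- themselves when they are adjacent.
common-count : ∀ n x y → x ≢ y →
  + common (allMats (E n)) (adjΓ (E n) (2≤E n)) x y
  ≡ ΣMat (E n) (λ z → nbr n x z *ℤ nbr n y z) +ℤ -ℤ (+ 2 *ℤ nbr n x y)
common-count n x y x≢y =
  trans (count-allMats (E n) (λ z → adjΓ (E n) (2≤E n) x z ∧ adjΓ (E n) (2≤E n) y z))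
  (trans (ΣMat-cong (E n) (λ z → trans (ind-∧ (adjΓ (E n) (2≤E n) x z) (adjΓ (E n) (2≤E n) y z))
                                 (trans (cong₂ _*ℤ_ (ind-adjΓ n x z) (ind-adjΓ n y z))
                                        (regroup (δx z) (δy z) (nbr n x z) (nbr n y z)))))
  (trans (ΣMat-punctured (E n) x (λ z → (+ 1 +ℤ -ℤ δy z) *ℤ (nbr n x z *ℤ nbr n y z)))
  (trans (cong (_+ℤ -ℤ ((+ 1 +ℤ -ℤ δy x) *ℤ (nbr n x x *ℤ nbr n y x)))
               (ΣMat-punctured (E n) y (λ z → nbr n x z *ℤ nbr n y z)))
         (collect (nbr-self n y) (nbr-self n x) (sym (nbr-comm n x y))
                  (cong ind (⌊⌋-false (y ≟M x) (λ y≡x → x≢y (sym y≡x))))))))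
  where
  δx δy : Mat (E n) → ℤ
  δx z = ind ⌊ x ≟M z ⌋
  δy z = ind ⌊ y ≟M z ⌋
  S = ΣMat (E n) (λ z → nbr n x z *ℤ nbr n y z)
  N = nbr n x y
  regroup : ∀ d d′ a a′ → ((+ 1 +ℤ -ℤ d) *ℤ a) *ℤ ((+ 1 +ℤ -ℤ d′) *ℤ a′)
                         ≡ (+ 1 +ℤ -ℤ d) *ℤ ((+ 1 +ℤ -ℤ d′) *ℤ (a *ℤ a′))
  regroup = solve-∀
  identity : ∀ S N → S +ℤ -ℤ (N *ℤ + 1) +ℤ -ℤ ((+ 1 +ℤ -ℤ + 0) *ℤ (+ 1 *ℤ N)) ≡ S +ℤ -ℤ (+ 2 *ℤ N)
  identity = solve-∀
  collect : ∀ {Nyy Nxx Nyx Δ} → Nyy ≡ + 1 → Nxx ≡ + 1 → Nyx ≡ N → Δ ≡ + 0 →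
    S +ℤ -ℤ (N *ℤ Nyy) +ℤ -ℤ ((+ 1 +ℤ -ℤ Δ) *ℤ (Nxx *ℤ Nyx)) ≡ S +ℤ -ℤ (+ 2 *ℤ N)
  collect refl refl refl refl = identity S N

clique-count : ∀ n x → inW₁ x ≡ false →
  + nbrsIn (allMats (E n)) (adjΓ (E n) (2≤E n)) (W₁ (E n)) x ≡ ΣMat (E n) (λ z → nbr n x z *ℤ χ z)
clique-count n x x∉W₁ =
  trans (count-filtered (E n) (adjΓ (E n) (2≤E n) x) inW₁)
  (trans (ΣMat-cong (E n) (λ z → trans (cong (_*ℤ χ z) (ind-adjΓ n x z))
                                       (ℤP.*-assoc (+ 1 +ℤ -ℤ ind ⌊ x ≟M z ⌋) (nbr n x z) (χ z))))
  (trans (ΣMat-punctured (E n) x (λ z → nbr n x z *ℤ χ z))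
         (trans (cong (λ t → ΣMat (E n) (λ z → nbr n x z *ℤ χ z) +ℤ -ℤ (nbr n x x *ℤ ind t)) x∉W₁)
                (trans (cong (λ t → ΣMat (E n) (λ z → nbr n x z *ℤ χ z) +ℤ -ℤ t) (ℤP.*-zeroʳ (nbr n x x)))
                       (ℤP.+-identityʳ (ΣMat (E n) (λ z → nbr n x z *ℤ χ z)))))))

-- Verified over all suffix pairs: the coefficient is 8 for adjacent pairs and one of
-- 0, 8, 16 otherwise (κ is the prefix part of the form; it vanishes when B holds).
coefOK : Bool → ℤ → Bool
coefOK false c = c == + 8
coefOK true  c = (c == + 0) ∨ ((c == + 8) ∨ (c == + 16))

coefTest : Mat 2 → Mat 2 → Vec Bool 2 → Bool
coefTest u w (B ∷ κ ∷ []) = (B ∧ κ) ∨ coefOK (κ xor Qˢ₂ B u w) (coef B u w)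

coef-check : ∀ B κ u w → (B ∧ κ) ∨ coefOK (κ xor Qˢ₂ B u w) (coef B u w) ≡ true
coef-check B κ u w =
  allVec-sound 2 (coefTest u w) (allPairs-sound (λ u w → allVec 2 (coefTest u w)) refl u w) (B ∷ κ ∷ [])

suffixCoef : ∀ n → Mat (E n) → Mat (E n) → ℤ
suffixCoef n x y = coef (bothPrefixZero n x y) (suffix n x) (suffix n y)

suffixCoef-OK : ∀ n x y {q} → Qˢ n x y ≡ q → coefOK q (suffixCoef n x y) ≡ true
suffixCoef-OK n x y refl =
  subst (λ q → coefOK q (suffixCoef n x y) ≡ true) (sym (Qˢ-split n x y))
        (∨-right (coef-check (bothPrefixZero n x y) (prefixQ n x y) (suffix n x) (suffix n y))
                 (prefixQ-inactive n x y))

common-formula : ∀ n x y → x ≢ y →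
  + 4 *ℤ + common (allMats (E n)) (adjΓ (E n) (2≤E n)) x y
  ≡ + 16 *ℤ (P n *ℤ P n) +ℤ P n *ℤ suffixCoef n x y +ℤ -ℤ (+ 8 *ℤ nbr n x y)
common-formula n x y x≢y =
  trans (cong (+ 4 *ℤ_) (common-count n x y x≢y))
  (trans (distribute (ΣMat (E n) (λ z → nbr n x z *ℤ nbr n y z)) (nbr n x y))
         (cong (_+ℤ -ℤ (+ 8 *ℤ nbr n x y)) (common-sum n x y x≢y)))
  where
  distribute : ∀ S N → + 4 *ℤ (S +ℤ -ℤ (+ 2 *ℤ N)) ≡ + 4 *ℤ S +ℤ -ℤ (+ 8 *ℤ N)
  distribute = solve-∀

-- Translating the parameters of the theorem, polynomials in 2^(e-1) with a
-- truncated subtraction, into polynomials in P = 2^(e-2) over ℤ.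
pos-∸ : ∀ {m k} → k ≤ m → + (m ∸ k) ≡ + m +ℤ -ℤ (+ k)
pos-∸ {m} {k} k≤m = trans (sym (ℤP.⊖-≥ k≤m)) (sym (ℤP.m-n≡m⊖n m k))

2^E-1 : ∀ n → + (2 ^ (E n ∸ 1)) ≡ + 2 *ℤ P n
2^E-1 n = ℤP.pos-* 2 (2 ^ n)

1≤2^ : ∀ k → 1 ≤ 2 ^ k
1≤2^ k = ℕP.m^n>0 2 k

vertices-value : ∀ n → + (2 ^ (2 * E n)) ≡ + 16 *ℤ (P n *ℤ P n)
vertices-value n =
  trans (cong (λ k → + (2 ^ (E n + k))) (ℕP.+-identityʳ (E n)))
  (trans (cong +_ (ℕP.^-distribˡ-+-* 2 (E n) (E n)))
  (trans (ℤP.pos-* (2 ^ E n) (2 ^ E n)) (trans (cong₂ _*ℤ_ (2^E n) (2^E n)) (square (P n)))))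
  where
  square : ∀ p → (+ 4 *ℤ p) *ℤ (+ 4 *ℤ p) ≡ + 16 *ℤ (p *ℤ p)
  square = solve-∀

k-value : ∀ n → + ((2 ^ (E n ∸ 1) + 1) * (2 ^ E n ∸ 1)) ≡ + 8 *ℤ (P n *ℤ P n) +ℤ + 2 *ℤ P n +ℤ -ℤ (+ 1)
k-value n =
  trans (ℤP.pos-* (2 ^ (E n ∸ 1) + 1) (2 ^ E n ∸ 1))
  (trans (cong₂ _*ℤ_ (trans (ℤP.pos-+ (2 ^ (E n ∸ 1)) 1) (cong (_+ℤ + 1) (2^E-1 n)))
                     (trans (pos-∸ (1≤2^ (E n))) (cong (_+ℤ -ℤ (+ 1)) (2^E n))))
         (expand (P n)))
  where
  expand : ∀ p → (+ 2 *ℤ p +ℤ + 1) *ℤ (+ 4 *ℤ p +ℤ -ℤ (+ 1)) ≡ + 8 *ℤ (p *ℤ p) +ℤ + 2 *ℤ p +ℤ -ℤ (+ 1)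
  expand = solve-∀

λ-value : ∀ n →
  + (2 * (2 ^ (E n ∸ 2) + 1) * (2 ^ (E n ∸ 1) ∸ 1)) ≡ + 4 *ℤ (P n *ℤ P n) +ℤ + 2 *ℤ P n +ℤ -ℤ (+ 2)
λ-value n =
  trans (ℤP.pos-* (2 * (2 ^ n + 1)) (2 ^ (E n ∸ 1) ∸ 1))
  (trans (cong₂ _*ℤ_ (trans (ℤP.pos-* 2 (2 ^ n + 1)) (cong (+ 2 *ℤ_) (ℤP.pos-+ (2 ^ n) 1)))
                     (trans (pos-∸ (1≤2^ (E n ∸ 1))) (cong (_+ℤ -ℤ (+ 1)) (2^E-1 n))))
         (expand (P n)))
  where
  expand : ∀ p → (+ 2 *ℤ (p +ℤ + 1)) *ℤ (+ 2 *ℤ p +ℤ -ℤ (+ 1)) ≡ + 4 *ℤ (p *ℤ p) +ℤ + 2 *ℤ p +ℤ -ℤ (+ 2)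
  expand = solve-∀

μ : ℕ → ℕ
μ n = 2 ^ (E n ∸ 1) * (2 ^ (E n ∸ 1) + 1)

2^E-1≤μ : ∀ n → 2 ^ (E n ∸ 1) ≤ μ n
2^E-1≤μ n = ℕP.≤-trans (ℕP.≤-reflexive (sym (ℕP.*-identityʳ a))) (ℕP.*-monoʳ-≤ a (ℕP.m≤n+m 1 a))
  where
  a = 2 ^ (E n ∸ 1)

μ-value : ∀ n → + μ n ≡ + 4 *ℤ (P n *ℤ P n) +ℤ + 2 *ℤ P n
μ-value n =
  trans (ℤP.pos-* (2 ^ (E n ∸ 1)) (2 ^ (E n ∸ 1) + 1))
  (trans (cong₂ _*ℤ_ (2^E-1 n) (trans (ℤP.pos-+ (2 ^ (E n ∸ 1)) 1) (cong (_+ℤ + 1) (2^E-1 n))))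
         (expand (P n)))
  where
  expand : ∀ p → (+ 2 *ℤ p) *ℤ (+ 2 *ℤ p +ℤ + 1) ≡ + 4 *ℤ (p *ℤ p) +ℤ + 2 *ℤ p
  expand = solve-∀

μ-minus-value : ∀ n → + (μ n ∸ 2 ^ (E n ∸ 1)) ≡ + 4 *ℤ (P n *ℤ P n)
μ-minus-value n =
  trans (pos-∸ (2^E-1≤μ n)) (trans (cong₂ (λ s t → s +ℤ -ℤ t) (μ-value n) (2^E-1 n)) (cancel (P n)))
  where
  cancel : ∀ p → + 4 *ℤ (p *ℤ p) +ℤ + 2 *ℤ p +ℤ -ℤ (+ 2 *ℤ p) ≡ + 4 *ℤ (p *ℤ p)
  cancel = solve-∀

μ-plus-value : ∀ n → + (μ n + 2 ^ (E n ∸ 1)) ≡ + 4 *ℤ (P n *ℤ P n) +ℤ + 4 *ℤ P n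
μ-plus-value n =
  trans (ℤP.pos-+ (μ n) (2 ^ (E n ∸ 1)))
  (trans (cong₂ _+ℤ_ (μ-value n) (2^E-1 n)) (collect (P n)))
  where
  collect : ∀ p → + 4 *ℤ (p *ℤ p) +ℤ + 2 *ℤ p +ℤ + 2 *ℤ p ≡ + 4 *ℤ (p *ℤ p) +ℤ + 4 *ℤ p
  collect = solve-∀

μ-minus-equation : ∀ n →
  + 16 *ℤ (P n *ℤ P n) +ℤ P n *ℤ + 0 +ℤ -ℤ (+ 8 *ℤ + 0) ≡ + 4 *ℤ + (μ n ∸ 2 ^ (E n ∸ 1))
μ-minus-equation n = trans (quarter (P n)) (cong (+ 4 *ℤ_) (sym (μ-minus-value n)))
  where
  quarter : ∀ p → + 16 *ℤ (p *ℤ p) +ℤ p *ℤ + 0 +ℤ -ℤ (+ 8 *ℤ + 0) ≡ + 4 *ℤ (+ 4 *ℤ (p *ℤ p))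
  quarter = solve-∀

μ-equation : ∀ n →
  + 16 *ℤ (P n *ℤ P n) +ℤ P n *ℤ + 8 +ℤ -ℤ (+ 8 *ℤ + 0) ≡ + 4 *ℤ + μ n
μ-equation n = trans (quarter (P n)) (cong (+ 4 *ℤ_) (sym (μ-value n)))
  where
  quarter : ∀ p → + 16 *ℤ (p *ℤ p) +ℤ p *ℤ + 8 +ℤ -ℤ (+ 8 *ℤ + 0) ≡ + 4 *ℤ (+ 4 *ℤ (p *ℤ p) +ℤ + 2 *ℤ p)
  quarter = solve-∀

μ-plus-equation : ∀ n →
  + 16 *ℤ (P n *ℤ P n) +ℤ P n *ℤ + 16 +ℤ -ℤ (+ 8 *ℤ + 0) ≡ + 4 *ℤ + (μ n + 2 ^ (E n ∸ 1))
μ-plus-equation n = trans (quarter (P n)) (cong (+ 4 *ℤ_) (sym (μ-plus-value n)))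
  where
  quarter : ∀ p → + 16 *ℤ (p *ℤ p) +ℤ p *ℤ + 16 +ℤ -ℤ (+ 8 *ℤ + 0) ≡ + 4 *ℤ (+ 4 *ℤ (p *ℤ p) +ℤ + 4 *ℤ p)
  quarter = solve-∀

cancel-to-ℕ : ∀ (k : ℤ) .{{_ : NonZero k}} {a b : ℕ} (V : ℤ) →
  k *ℤ + a ≡ k *ℤ V → + b ≡ V → a ≡ b
cancel-to-ℕ k V ka≡kV b≡V = ℤP.+-injective (trans (ℤP.*-cancelˡ-≡ k _ _ ka≡kV) (sym b≡V))

adjacent⇒distinct : ∀ n x y → adjΓ (E n) (2≤E n) x y ≡ true → x ≢ y
adjacent⇒distinct n x .x x~x refl
  rewrite adjΓ-char n x x | Qˢ-irreflexive n x | ⌊⌋-true (x ≟M x) refl with x~x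
... | ()

adjacent⇒Qˢ : ∀ n x y → adjΓ (E n) (2≤E n) x y ≡ true → Qˢ n x y ≡ false
adjacent⇒Qˢ n x y x~y = not≡true (proj₂ (∧-true (trans (sym (adjΓ-char n x y)) x~y)))

nonadjacent⇒Qˢ : ∀ n x y → x ≢ y → adjΓ (E n) (2≤E n) x y ≡ false → Qˢ n x y ≡ true
nonadjacent⇒Qˢ n x y x≢y x≁y
  rewrite adjΓ-char n x y | ⌊⌋-false (x ≟M y) x≢y with Qˢ n x y | x≁y
... | true | _ = refl

Qˢ⇒adjacent : ∀ n x y → x ≢ y → Qˢ n x y ≡ false → adjΓ (E n) (2≤E n) x y ≡ true
Qˢ⇒adjacent n x y x≢y q rewrite adjΓ-char n x y | ⌊⌋-false (x ≟M y) x≢y | q = refl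

Qˢ⇒nonadjacent : ∀ n x y → Qˢ n x y ≡ true → adjΓ (E n) (2≤E n) x y ≡ false
Qˢ⇒nonadjacent n x y q rewrite adjΓ-char n x y | q = BP.∧-zeroʳ _

degree-value : ∀ n x → degree (allMats (E n)) (adjΓ (E n) (2≤E n)) x ≡ (2 ^ (E n ∸ 1) + 1) * (2 ^ E n ∸ 1)
degree-value n x =
  cancel-to-ℕ (+ 2) (+ 8 *ℤ (P n *ℤ P n) +ℤ + 2 *ℤ P n +ℤ -ℤ (+ 1))
    (trans (cong (+ 2 *ℤ_) (degree-count n x))
    (trans (distribute (ΣMat (E n) (nbr n x)))
    (trans (cong (_+ℤ -ℤ (+ 2)) (degree-sum n x)) (halve (P n)))))
    (k-value n)
  where
  distribute : ∀ S → + 2 *ℤ (S +ℤ -ℤ (+ 1)) ≡ + 2 *ℤ S +ℤ -ℤ (+ 2)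
  distribute = solve-∀
  halve : ∀ p → + 16 *ℤ (p *ℤ p) +ℤ + 4 *ℤ p +ℤ -ℤ (+ 2) ≡ + 2 *ℤ (+ 8 *ℤ (p *ℤ p) +ℤ + 2 *ℤ p +ℤ -ℤ (+ 1))
  halve = solve-∀

common-value : ∀ n x y → x ≢ y → (c N : ℤ) (V : ℕ) → suffixCoef n x y ≡ c → nbr n x y ≡ N →
  + 16 *ℤ (P n *ℤ P n) +ℤ P n *ℤ c +ℤ -ℤ (+ 8 *ℤ N) ≡ + 4 *ℤ + V →
  common (allMats (E n)) (adjΓ (E n) (2≤E n)) x y ≡ V
common-value n x y x≢y c N V coef≡c nbr≡N value =
  ℤP.+-injective (ℤP.*-cancelˡ-≡ (+ 4) _ _
    (trans (common-formula n x y x≢y)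
           (trans (cong₂ (λ c N → + 16 *ℤ (P n *ℤ P n) +ℤ P n *ℤ c +ℤ -ℤ (+ 8 *ℤ N)) coef≡c nbr≡N) value)))

common-adjacent : ∀ n x y → adjΓ (E n) (2≤E n) x y ≡ true →
  common (allMats (E n)) (adjΓ (E n) (2≤E n)) x y ≡ 2 * (2 ^ (E n ∸ 2) + 1) * (2 ^ (E n ∸ 1) ∸ 1)
common-adjacent n x y x~y =
  common-value n x y (adjacent⇒distinct n x y x~y) (+ 8) (+ 1) _
    (==-sound _ _ (suffixCoef-OK n x y (adjacent⇒Qˢ n x y x~y)))
    (cong (λ b → ind (not b)) (adjacent⇒Qˢ n x y x~y))
    (trans (quarter (P n)) (cong (+ 4 *ℤ_) (sym (λ-value n))))
  where
  quarter : ∀ p →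
    + 16 *ℤ (p *ℤ p) +ℤ p *ℤ + 8 +ℤ -ℤ (+ 8 *ℤ + 1) ≡ + 4 *ℤ (+ 4 *ℤ (p *ℤ p) +ℤ + 2 *ℤ p +ℤ -ℤ (+ 2))
  quarter = solve-∀

common-nonadjacent-value : ∀ n x y → x ≢ y → adjΓ (E n) (2≤E n) x y ≡ false → (c : ℤ) (V : ℕ) →
  suffixCoef n x y ≡ c → + 16 *ℤ (P n *ℤ P n) +ℤ P n *ℤ c +ℤ -ℤ (+ 8 *ℤ + 0) ≡ + 4 *ℤ + V →
  common (allMats (E n)) (adjΓ (E n) (2≤E n)) x y ≡ V
common-nonadjacent-value n x y x≢y x≁y c V coef≡c =
  common-value n x y x≢y c (+ 0) V coef≡c (cong (λ b → ind (not b)) (nonadjacent⇒Qˢ n x y x≢y x≁y))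

three-values : ∀ c → coefOK true c ≡ true → c ≡ + 0 ⊎ c ≡ + 8 ⊎ c ≡ + 16
three-values c ok with c == + 0 in is0 | c == + 8 in is8
... | true  | _     = inj₁ (==-sound c _ is0)
... | false | true  = inj₂ (inj₁ (==-sound c _ is8))
... | false | false = inj₂ (inj₂ (==-sound c _ ok))

common-nonadjacent : ∀ n x y → x ≢ y → adjΓ (E n) (2≤E n) x y ≡ false →
  let c = common (allMats (E n)) (adjΓ (E n) (2≤E n)) x y in
  c ≡ μ n ∸ 2 ^ (E n ∸ 1) ⊎ c ≡ μ n ⊎ c ≡ μ n + 2 ^ (E n ∸ 1)
common-nonadjacent n x y x≢y x≁y =
  values (three-values (suffixCoef n x y) (suffixCoef-OK n x y (nonadjacent⇒Qˢ n x y x≢y x≁y)))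
  where
  C = common (allMats (E n)) (adjΓ (E n) (2≤E n)) x y
  c = suffixCoef n x y
  value = common-nonadjacent-value n x y x≢y x≁y
  values : c ≡ + 0 ⊎ c ≡ + 8 ⊎ c ≡ + 16 → C ≡ μ n ∸ 2 ^ (E n ∸ 1) ⊎ C ≡ μ n ⊎ C ≡ μ n + 2 ^ (E n ∸ 1)
  values (inj₁ c≡0)        = inj₁ (value (+ 0) _ c≡0 (μ-minus-equation n))
  values (inj₂ (inj₁ c≡8))  = inj₂ (inj₁ (value (+ 8) _ c≡8 (μ-equation n)))
  values (inj₂ (inj₂ c≡16)) = inj₂ (inj₂ (value (+ 16) _ c≡16 (μ-plus-equation n)))

length-sum : ∀ {A : Set} (L : List A) → + length L ≡ sumL (map (λ _ → + 1) L)
length-sum []      = refl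
length-sum (x ∷ L) = trans (ℤP.pos-+ 1 (length L)) (cong (+ 1 +ℤ_) (length-sum L))

length-allMats : ∀ n → length (allMats (E n)) ≡ 2 ^ (2 * E n)
length-allMats n =
  ℤP.+-injective (trans (length-sum (allMats (E n)))
                 (trans (allMats-sum (E n) (λ _ → + 1)) (trans (ΣMat-one n) (sym (vertices-value n)))))

length-W₁ : ∀ n → length (W₁ (E n)) ≡ 2 ^ E n
length-W₁ n = ℤP.+-injective (trans (count-allMats (E n) inW₁) (trans (ΣMat-χ n) (sym (2^E n))))

-- W₁ is a clique: its elements have zero prefix, and the two suffixes are adjacent.
W₁-adjacent : ∀ n x y → inW₁ x ≡ true → inW₁ y ≡ true → x ≢ y → adjΓ (E n) (2≤E n) x y ≡ true
W₁-adjacent n x y x∈W₁ y∈W₁ x≢y =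
  Qˢ⇒adjacent n x y x≢y
    (trans (Qˢ-split n x y)
    (trans (cong₂ (λ κ B → κ xor Qˢ₂ B (suffix n x) (suffix n y))
                  (prefixQ-vanishes n x y (proj₁ x-split) (proj₁ y-split))
                  (cong₂ _∧_ (proj₁ x-split) (proj₁ y-split)))
           (suffix-check (suffix n x) (suffix n y) (proj₂ x-split) (proj₂ y-split))))
  where
  x-split = ∧-true (trans (sym (inW₁-split n x)) x∈W₁)
  y-split = ∧-true (trans (sym (inW₁-split n y)) y∈W₁)
  suffix-check : ∀ u w → inW₁ u ≡ true → inW₁ w ≡ true → Qˢ₂ true u w ≡ false
  suffix-check u w u∈ w∈ = not≡true
    (∨-right (∨-right (allPairs-sound (λ u w → not (inW₁ u) ∨ (not (inW₁ w) ∨ not (Qˢ₂ true u w))) refl u w)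
                      (cong not u∈))
             (cong not w∈))

∉W₁ : ∀ n x → x ∉ W₁ (E n) → inW₁ x ≡ false
∉W₁ n x x∉ with inW₁ x in eq
... | true  =
  ⊥-elim (x∉ (∈-filter⁺ (λ z → inW₁ z B.≟ true) {xs = allMats (E n)} (allMats-complete (E n) x) eq))
... | false = refl

W₁-regularClique : ∀ n → RegularClique (allMats (E n)) (adjΓ (E n) (2≤E n)) (2 ^ (E n ∸ 1)) (W₁ (E n))
W₁-regularClique n =
  (filter⁺ W₁? (allMats-unique (E n)) , (λ x x∈ → proj₁ (∈-filter⁻ W₁? {xs = allMats (E n)} x∈))
   , λ x y x∈ y∈ → W₁-adjacent n x y (proj₂ (∈-filter⁻ W₁? {xs = allMats (E n)} x∈))
                                       (proj₂ (∈-filter⁻ W₁? {xs = allMats (E n)} y∈)))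
  , ℕP.m^n>0 2 (E n ∸ 1)
  , λ x _ x∉ → cancel-to-ℕ (+ 2) (+ 2 *ℤ P n)
                 (trans (cong (+ 2 *ℤ_) (clique-count n x (∉W₁ n x x∉)))
                        (trans (clique-sum n x (∉W₁ n x x∉)) (ℤP.*-assoc (+ 2) (+ 2) (P n))))
                 (2^E-1 n)
  where
  W₁? = λ (z : Mat (E n)) → inW₁ z B.≟ true

embed : ∀ n → Mat 2 → Mat (E n)
embed zero    u = u
embed (suc n) u = false ∷ proj₁ (embed n u) , false ∷ proj₂ (embed n u)

suffix-embed : ∀ n u → suffix n (embed n u) ≡ u
suffix-embed zero    u = refl
suffix-embed (suc n) u = suffix-embed n u

prefixZero-embed : ∀ n u → prefixZero n (embed n u) ≡ true
prefixZero-embed zero    u = refl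
prefixZero-embed (suc n) u = prefixZero-embed n u

embed-injective : ∀ n {u w} → embed n u ≡ embed n w → u ≡ w
embed-injective n {u} {w} eq =
  trans (sym (suffix-embed n u)) (trans (cong (suffix n) eq) (suffix-embed n w))

Qˢ-embed : ∀ n u w → Qˢ n (embed n u) (embed n w) ≡ Qˢ₂ true u w
Qˢ-embed n u w =
  trans (Qˢ-split n (embed n u) (embed n w))
  (cong₃ (λ κ B s t → κ xor Qˢ₂ B s t)
     (prefixQ-vanishes n _ _ (prefixZero-embed n u) (prefixZero-embed n w))
     (cong₂ _∧_ (prefixZero-embed n u) (prefixZero-embed n w)) (suffix-embed n u) (suffix-embed n w))
  where
  cong₃ : ∀ {A B C D R : Set} (f : A → B → C → D → R) {a a′ b b′ c c′ d d′} →
    a ≡ a′ → b ≡ b′ → c ≡ c′ → d ≡ d′ → f a b c d ≡ f a′ b′ c′ d′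
  cong₃ f refl refl refl refl = refl

suffixCoef-embed : ∀ n u w → suffixCoef n (embed n u) (embed n w) ≡ coef true u w
suffixCoef-embed n u w =
  trans (cong (λ B → coef B (suffix n (embed n u)) (suffix n (embed n w)))
              (cong₂ _∧_ (prefixZero-embed n u) (prefixZero-embed n w)))
        (cong₂ (coef true) (suffix-embed n u) (suffix-embed n w))

-- The zero matrix, and partners realising an edge and the three values of μ.
o edge pair₀ pair₋ pair₊ : Mat 2
o     = false ∷ false ∷ [] , false ∷ false ∷ []
edge  = false ∷ false ∷ [] , false ∷ true  ∷ []
pair₀ = false ∷ false ∷ [] , true  ∷ true  ∷ []
pair₋ = false ∷ true  ∷ [] , false ∷ true  ∷ []
pair₊ = true  ∷ true  ∷ [] , false ∷ true  ∷ []

NonAdjacentPair : ℕ → ℕ → Set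
NonAdjacentPair n c =
  ∃[ x ] ∃[ y ] (x ∈ allMats (E n) × y ∈ allMats (E n) × x ≢ y × adjΓ (E n) (2≤E n) x y ≡ false
                 × common (allMats (E n)) (adjΓ (E n) (2≤E n)) x y ≡ c)

nonadjacent-witness : ∀ n w (V : ℕ) → o ≢ w → Qˢ₂ true o w ≡ true →
  + 16 *ℤ (P n *ℤ P n) +ℤ P n *ℤ coef true o w +ℤ -ℤ (+ 8 *ℤ + 0) ≡ + 4 *ℤ + V → NonAdjacentPair n V
nonadjacent-witness n w V o≢w q value =
  embed n o , embed n w , allMats-complete (E n) _ , allMats-complete (E n) _ , distinct
  , nonadjacent
  , common-nonadjacent-value n (embed n o) (embed n w) distinct nonadjacent (coef true o w) V
                             (suffixCoef-embed n o w) value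
  where
  distinct : embed n o ≢ embed n w
  distinct eq = o≢w (embed-injective n eq)
  nonadjacent : adjΓ (E n) (2≤E n) (embed n o) (embed n w) ≡ false
  nonadjacent = Qˢ⇒nonadjacent n (embed n o) (embed n w) (trans (Qˢ-embed n o w) q)

μ-minus-witness : ∀ n → NonAdjacentPair n (μ n ∸ 2 ^ (E n ∸ 1))
μ-minus-witness n = nonadjacent-witness n pair₋ _ (λ ()) refl (μ-minus-equation n)

μ-witness : ∀ n → NonAdjacentPair n (μ n)
μ-witness n = nonadjacent-witness n pair₀ _ (λ ()) refl (μ-equation n)

μ-plus-witness : ∀ n → NonAdjacentPair n (μ n + 2 ^ (E n ∸ 1))
μ-plus-witness n = nonadjacent-witness n pair₊ _ (λ ()) refl (μ-plus-equation n)

edgeRegular : ∀ n → EdgeRegular (allMats (E n)) (adjΓ (E n) (2≤E n)) (2 ^ (2 * E n))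
  ((2 ^ (E n ∸ 1) + 1) * (2 ^ E n ∸ 1)) (2 * (2 ^ (E n ∸ 2) + 1) * (2 ^ (E n ∸ 1) ∸ 1))
edgeRegular n =
  length-allMats n
  , (embed n o , embed n edge , allMats-complete (E n) _ , allMats-complete (E n) _
    , Qˢ⇒adjacent n (embed n o) (embed n edge) (λ eq → o≢edge (embed-injective n eq))
                  (trans (Qˢ-embed n o edge) refl))
  , (λ x _ → degree-value n x)
  , (λ x y _ _ → common-adjacent n x y)
  where
  o≢edge : o ≢ edge
  o≢edge ()

not-stronglyRegular : ∀ n → ¬ StronglyRegular (allMats (E n)) (adjΓ (E n) (2≤E n))
not-stronglyRegular n (_ , _ , m , constant) =
  ℕP.<⇒≢ (ℕP.∸-monoʳ-< (1≤2^ (E n ∸ 1)) (2^E-1≤μ n))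
         (trans (common-of (μ-minus-witness n)) (sym (common-of (μ-witness n))))
  where
  common-of : ∀ {c} → NonAdjacentPair n c → c ≡ m
  common-of (x , y , x∈ , y∈ , x≢y , x≁y , common≡c) = trans (sym common≡c) (constant x y x∈ y∈ x≢y x≁y)

theorem19 : (e : ℕ) (h : 2 ≤ e) →
    StrictlyNeumaier (allMats e) (adjΓ e h)
    × EdgeRegular (allMats e) (adjΓ e h) (2 ^ (2 * e))
        ((2 ^ (e ∸ 1) + 1) * (2 ^ e ∸ 1))
        (2 * (2 ^ (e ∸ 2) + 1) * (2 ^ (e ∸ 1) ∸ 1))
    × (∃[ S ] (length S ≡ 2 ^ e × RegularClique (allMats e) (adjΓ e h) (2 ^ (e ∸ 1)) S))
    × (∀ x y → x ∈ allMats e → y ∈ allMats e → x ≢ y → adjΓ e h x y ≡ false →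
        common (allMats e) (adjΓ e h) x y ≡ 2 ^ (e ∸ 1) * (2 ^ (e ∸ 1) + 1) ∸ 2 ^ (e ∸ 1)
        ⊎ common (allMats e) (adjΓ e h) x y ≡ 2 ^ (e ∸ 1) * (2 ^ (e ∸ 1) + 1)
        ⊎ common (allMats e) (adjΓ e h) x y ≡ 2 ^ (e ∸ 1) * (2 ^ (e ∸ 1) + 1) + 2 ^ (e ∸ 1))
    × (∃[ x ] ∃[ y ] (x ∈ allMats e × y ∈ allMats e × x ≢ y × adjΓ e h x y ≡ false
        × common (allMats e) (adjΓ e h) x y ≡ 2 ^ (e ∸ 1) * (2 ^ (e ∸ 1) + 1) ∸ 2 ^ (e ∸ 1)))
    × (∃[ x ] ∃[ y ] (x ∈ allMats e × y ∈ allMats e × x ≢ y × adjΓ e h x y ≡ false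
        × common (allMats e) (adjΓ e h) x y ≡ 2 ^ (e ∸ 1) * (2 ^ (e ∸ 1) + 1)))
    × (∃[ x ] ∃[ y ] (x ∈ allMats e × y ∈ allMats e × x ≢ y × adjΓ e h x y ≡ false
        × common (allMats e) (adjΓ e h) x y ≡ 2 ^ (e ∸ 1) * (2 ^ (e ∸ 1) + 1) + 2 ^ (e ∸ 1)))
theorem19 (suc (suc n)) (s≤s (s≤s z≤n)) =
  ( nonComplete (μ-witness n)
  , (_ , _ , _ , edgeRegular n)
  , (_ , _ , W₁-regularClique n)
  , not-stronglyRegular n )
  , edgeRegular n
  , (W₁ (E n) , length-W₁ n , W₁-regularClique n)
  , (λ x y _ _ → common-nonadjacent n x y)
  , μ-minus-witness n
  , μ-witness n
  , μ-plus-witness n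
  where
  nonComplete : ∀ {c} → NonAdjacentPair n c → NonComplete (allMats (E n)) (adjΓ (E n) (2≤E n))
  nonComplete (x , y , x∈ , y∈ , x≢y , x≁y , _) = x , y , x∈ , y∈ , x≢y , x≁y
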